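{- Let $u\parallel_a v$ be a term of $\mathsf{LC}^\star$ of type $C$, where $a$ has type $A\to B$ in $u$ and type $B\to A$ in $v$. Define $\mathscr A:=\lambda x^A\,\mathcal A^{C\to B}\,(v[\lambda y^B x/a])$ and $\mathscr B:=\lambda z^B\,\mathcal A^{C\to A}\,(u[\lambda y^A z/a])$, with $y$ a dummy variable. Then: if $u\parallel_a v\succ u'\parallel_a v$ then $u[\mathscr A/a]\succ^+u'[\mathscr A/a]$; and if $u\parallel_a v\succ u\parallel_a v'$ then $v[\mathscr B/a]\succ^+v'[\mathscr B/a]$.
   Context: Formulas. Terms of the first-order language $\mathcal{L}$ are individual variables, constants, and $f(m_1,\dots,m_n)$; atomic formulas are $P(m_1,\dots,m_n)$ including $0$-ary $\bot$; formulas are built with $\wedge,\vee,\to,\forall\alpha,\exists\alpha$. Proof terms of $\mathsf{LC}$ (Church-typed): $x^A:A$; $\langle u,t\rangle:A\wedge B$ from $u:A,t:B$; $u\pi_0:A$, $u\pi_1:B$ from $u:A\wedge B$; $tu:B$ from $t:A\to B,u:A$; $\lambda x^Au:A\to B$ from $u:B$; $\iota_0(u):A\vee B$ from $u:A$, $\iota_1(u):A\vee B$ from $u:B$; $u[x^A.w_1,y^B.w_2]:C$ from $u:A\vee B$, $w_1,w_2:C$; $um:A[m/\alpha]$ from $u:\forall\alpha A$; $\lambda\alpha u:\forall\alpha A$ from $u:A$ ($\alpha$ not free in types of free proof variables of $u$); $(m,u):\exists\alpha A$ from $u:A[m/\alpha]$; $u[(\alpha,x^A).t]:C$ from $u:\exists\alpha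 A$, $t:C$ (usual eigenvariable condition); $u\parallel_a v:C$ from $u:C$, $v:C$, where $a$ occurs in $u$ with type $A\to B$ and in $v$ with type $B\to A$, $\parallel_a$ binding $a$; $\mathsf{efq}_P(u):P$ from $u:\bot$, $P$ atomic. $\mathsf{LC}^\star$ adds constants $\mathcal A^{A\to B}:A\to B$ (abort) for all $A,B$. Stacks: finite sequences $\sigma=\sigma_1\cdot\ldots\cdot\sigma_n$ with components proof terms, terms of $\mathcal L$, $\pi_0,\pi_1$, $[x.u,y.v]$, $[(\alpha,x).v]$; $\epsilon$ empty; $t\sigma=((t\sigma_1)\ldots)\sigma_n$. Parallel context: $u_1\parallel_{a_1}\cdots[\,]\cdots\parallel_{a_n}u_n$. Basic reductions: $(\lambda xu)t\mapsto u[t/x]$; $(\lambda\alpha u)m\mapsto u[m/\alpha]$; $\langle u_0,u_1\rangle\pi_i\mapsto u_i$; $\iota_i(u)[x_0.t_0,x_1.t_1]\mapsto t_i[u/x_i]$; $(m,u)[(\alpha,x).v]\mapsto v[m/\alpha][u/x]$; $(u\parallel_a v)\xi\mapsto u\xi\parallel_a v\xi$ for $\xi$ a stack element that is a proof term, $\pi_i$, $[x.w_1,y.w_2]$ or $[(\alpha,x).w]$ in which $a$ is not free; $\mathcal C[a^{A\to B}u\sigma]\parallel_a v\mapsto\mathcal C[v[\lambda y^Bu/a^{B\to A}]]\parallel_a v$ and $v\parallel_a\mathcal C[a^{A\to B}u\sigma]\mapsto v\parallel_a\mathcal C[v[\lambda y^Bu/a^{B\to A}]]$ ($\mathcal C$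 parallel context, $a$ free in $\mathcal C[au\sigma]$, $y$ dummy); $\mathcal Au\sigma\mapsto u$ when $\mathcal Au\sigma$ and $u$ have the same type. Head reduction $\succ$: writing $t=t_1\parallel_{a_1}\cdots\parallel_{a_n}t_{n+1}$ (parentheses omitted), the $t_i$ are the parallel processes (elementary if not of the form $u\parallel_a v$). The head redex of $t$ is $h$ where $t=h\sigma$ and $h=r\xi$ with $\xi$ one stack element and $r$ one of $\lambda xu,\lambda\alpha u,\langle u,v\rangle,\iota_i(u),(m,u),u\parallel_a v$ (with $h$ a redex), or $h=t$ if $t=u\parallel_a v$ is a redex, or $h=t=\mathcal Au\sigma$ if $u$ and $t$ have the same type. The starting symbol of a redex $r\xi$ is its opening parenthesis; of a redex $u\parallel_a v$ it is the leftmost occurrence of $a$ heading an elementary process $a\,s\,\rho$. $t\succ t'$ iff $t'$ is obtained by contracting the head redex whose starting symbol is leftmost among the head redexes of the parallel processes of $t$. $\succ^+$ is the transitive closure of $\succ$. -}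

module Defs where

open import Data.Nat using (ℕ; zero; suc; _+_; _≤_)
open import Data.List using (List; []; _∷_; map)
open import Data.Product using (Σ; _×_; _,_)
open import Relation.Binary.PropositionalEquality using (_≡_; _≢_)
open import Relation.Binary.Construct.Closure.Transitive using (TransClosure)
open import Relation.Nullary using (¬_)

-- The first-order language L.  Individual variables are de Bruijn
-- indices; constants, function and predicate symbols are named by ℕ.

data Tm : Set where
  ivar  : ℕ → Tm
  const : ℕ → Tm
  fn    : ℕ → List Tm → Tm

data Fm : Set where
  atom : ℕ → List Tm → Fm
  ⊥'   : Fm
  _∧'_ : Fm → Fm → Fm
  _∨'_ : Fm → Fm → Fm
  _⇒_  : Fm → Fm → Fm
  ∀'   : Fm → Fm          -- ∀α A, α = individual index 0 in A
  ∃'   : Fm → Fm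

infixr 6 _∧'_
infixr 5 _∨'_
infixr 4 _⇒_

data Atomic : Fm → Set where
  atomA : ∀ p ms → Atomic (atom p ms)
  botA  : Atomic ⊥'

mutual
  renT : (ℕ → ℕ) → Tm → Tm
  renT ρ (ivar i)   = ivar (ρ i)
  renT ρ (const c)  = const c
  renT ρ (fn f ms)  = fn f (renTs ρ ms)

  renTs : (ℕ → ℕ) → List Tm → List Tm
  renTs ρ []       = []
  renTs ρ (m ∷ ms) = renT ρ m ∷ renTs ρ ms

mutual
  substT : (ℕ → Tm) → Tm → Tm
  substT σ (ivar i)  = σ i
  substT σ (const c) = const c
  substT σ (fn f ms) = fn f (substTs σ ms)

  substTs : (ℕ → Tm) → List Tm → List Tm
  substTs σ []       = []
  substTs σ (m ∷ ms) = substT σ m ∷ substTs σ ms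

liftT : (ℕ → Tm) → ℕ → Tm
liftT σ zero    = ivar zero
liftT σ (suc i) = renT suc (σ i)

substF : (ℕ → Tm) → Fm → Fm
substF σ (atom p ms) = atom p (substTs σ ms)
substF σ ⊥'          = ⊥'
substF σ (A ∧' B)    = substF σ A ∧' substF σ B
substF σ (A ∨' B)    = substF σ A ∨' substF σ B
substF σ (A ⇒ B)     = substF σ A ⇒ substF σ B
substF σ (∀' A)      = ∀' (substF (liftT σ) A)
substF σ (∃' A)      = ∃' (substF (liftT σ) A)

-- m :: id  (the substitution [m/α] for α = index 0, lowering the others)
consT : Tm → ℕ → Tm
consT m zero    = m
consT m (suc i) = ivar i

_[_]F : Fm → Tm → Fm
A [ m ]F = substF (consT m) A

shiftF : Fm → Fm
shiftF = substF (λ i → ivar (suc i))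

-- Raw (Church-annotated) proof terms of LC*, proof variables as
-- de Bruijn indices.  Eliminations are stack elements.

mutual
  data PT : Set where
    pv    : ℕ → PT                  -- x^A (type given by the context)
    _·_   : PT → Elim → PT
    pair  : PT → PT → PT
    lam   : Fm → PT → PT
    inj0  : Fm → PT → PT            -- ι₀(u) : A ∨ B, annotated with B
    inj1  : Fm → PT → PT            -- ι₁(u) : A ∨ B, annotated with A
    Lam   : PT → PT
    wit   : Fm → Tm → PT → PT       -- (m,u) : ∃α A, annotated with A
    par   : Fm → Fm → PT → PT → PT  -- u ∥_a v, a : A→B in u, a : B→A in v
    efq   : Fm → PT → PT
    abort : Fm → Fm → PT

  data Elim : Set where
    argP : PT → Elim
    argT : Tm → Elim
    prj0 : Elim
    prj1 : Elim
    case : Fm → Fm → PT → PT → Elim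
    exE  : Fm → PT → Elim

infixl 9 _·_

_◂_ : PT → List Elim → PT
t ◂ []      = t
t ◂ (ξ ∷ σ) = (t · ξ) ◂ σ

liftR : (ℕ → ℕ) → ℕ → ℕ
liftR ρ zero    = zero
liftR ρ (suc i) = suc (ρ i)

mutual
  renP : (ℕ → ℕ) → PT → PT
  renP ρ (pv i)         = pv (ρ i)
  renP ρ (t · ξ)        = renP ρ t · renE ρ ξ
  renP ρ (pair u t)     = pair (renP ρ u) (renP ρ t)
  renP ρ (lam A u)      = lam A (renP (liftR ρ) u)
  renP ρ (inj0 B u)     = inj0 B (renP ρ u)
  renP ρ (inj1 A u)     = inj1 A (renP ρ u)
  renP ρ (Lam u)        = Lam (renP ρ u)
  renP ρ (wit A m u)    = wit A m (renP ρ u)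
  renP ρ (par A B u v)  = par A B (renP (liftR ρ) u) (renP (liftR ρ) v)
  renP ρ (efq P u)      = efq P (renP ρ u)
  renP ρ (abort A B)    = abort A B

  renE : (ℕ → ℕ) → Elim → Elim
  renE ρ (argP u)         = argP (renP ρ u)
  renE ρ (argT m)         = argT m
  renE ρ prj0             = prj0
  renE ρ prj1             = prj1
  renE ρ (case A B w₁ w₂) = case A B (renP (liftR ρ) w₁) (renP (liftR ρ) w₂)
  renE ρ (exE A w)        = exE A (renP (liftR ρ) w)

mutual
  substIP : (ℕ → Tm) → PT → PT
  substIP σ (pv i)        = pv i
  substIP σ (t · ξ)       = substIP σ t · substIE σ ξ
  substIP σ (pair u t)    = pair (substIP σ u) (substIP σ t)
  substIP σ (lam A u)     = lam (substF σ A) (substIP σ u)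
  substIP σ (inj0 B u)    = inj0 (substF σ B) (substIP σ u)
  substIP σ (inj1 A u)    = inj1 (substF σ A) (substIP σ u)
  substIP σ (Lam u)       = Lam (substIP (liftT σ) u)
  substIP σ (wit A m u)   = wit (substF (liftT σ) A) (substT σ m) (substIP σ u)
  substIP σ (par A B u v) = par (substF σ A) (substF σ B) (substIP σ u) (substIP σ v)
  substIP σ (efq P u)     = efq (substF σ P) (substIP σ u)
  substIP σ (abort A B)   = abort (substF σ A) (substF σ B)

  substIE : (ℕ → Tm) → Elim → Elim
  substIE σ (argP u)         = argP (substIP σ u)
  substIE σ (argT m)         = argT (substT σ m)
  substIE σ prj0             = prj0
  substIE σ prj1             = prj1
  substIE σ (case A B w₁ w₂) = case (substF σ A) (substF σ B) (substIP σ w₁) (substIP σ w₂)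
  substIE σ (exE A w)        = exE (substF (liftT σ) A) (substIP (liftT σ) w)

shiftIP : PT → PT
shiftIP = substIP (λ i → ivar (suc i))

isub1 : Tm → PT → PT
isub1 m = substIP (consT m)

liftP : (ℕ → PT) → ℕ → PT
liftP σ zero    = pv zero
liftP σ (suc i) = renP suc (σ i)

liftPI : (ℕ → PT) → ℕ → PT
liftPI σ i = shiftIP (σ i)

mutual
  substP : (ℕ → PT) → PT → PT
  substP σ (pv i)        = σ i
  substP σ (t · ξ)       = substP σ t · substE σ ξ
  substP σ (pair u t)    = pair (substP σ u) (substP σ t)
  substP σ (lam A u)     = lam A (substP (liftP σ) u)
  substP σ (inj0 B u)    = inj0 B (substP σ u)
  substP σ (inj1 A u)    = inj1 A (substP σ u)
  substP σ (Lam u)       = Lam (substP (liftPI σ) u)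
  substP σ (wit A m u)   = wit A m (substP σ u)
  substP σ (par A B u v) = par A B (substP (liftP σ) u) (substP (liftP σ) v)
  substP σ (efq P u)     = efq P (substP σ u)
  substP σ (abort A B)   = abort A B

  substE : (ℕ → PT) → Elim → Elim
  substE σ (argP u)         = argP (substP σ u)
  substE σ (argT m)         = argT m
  substE σ prj0             = prj0
  substE σ prj1             = prj1
  substE σ (case A B w₁ w₂) = case A B (substP (liftP σ) w₁) (substP (liftP σ) w₂)
  substE σ (exE A w)        = exE A (substP (liftP (liftPI σ)) w)

consP : PT → ℕ → PT
consP t zero    = t
consP t (suc i) = pv i

sub1 : PT → PT → PT
sub1 t = substP (consP t)

-- Typing (Church style: the type of a term is determined by the term
-- and the types of its free proof variables).

data _∋_∶_ : List Fm → ℕ → Fm → Set where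
  here  : ∀ {Γ A} → (A ∷ Γ) ∋ zero ∶ A
  there : ∀ {Γ A B i} → Γ ∋ i ∶ A → (B ∷ Γ) ∋ suc i ∶ A

infix 2 _∋_∶_ _⊢_∶_

data _⊢_∶_ : List Fm → PT → Fm → Set where
  ⊢var   : ∀ {Γ i A} → Γ ∋ i ∶ A → Γ ⊢ pv i ∶ A
  ⊢pair  : ∀ {Γ u t A B} → Γ ⊢ u ∶ A → Γ ⊢ t ∶ B → Γ ⊢ pair u t ∶ A ∧' B
  ⊢π0    : ∀ {Γ u A B} → Γ ⊢ u ∶ A ∧' B → Γ ⊢ u · prj0 ∶ A
  ⊢π1    : ∀ {Γ u A B} → Γ ⊢ u ∶ A ∧' B → Γ ⊢ u · prj1 ∶ B
  ⊢app   : ∀ {Γ t u A B} → Γ ⊢ t ∶ A ⇒ B → Γ ⊢ u ∶ A → Γ ⊢ t · argP u ∶ B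
  ⊢lam   : ∀ {Γ u A B} → (A ∷ Γ) ⊢ u ∶ B → Γ ⊢ lam A u ∶ A ⇒ B
  ⊢inj0  : ∀ {Γ u A B} → Γ ⊢ u ∶ A → Γ ⊢ inj0 B u ∶ A ∨' B
  ⊢inj1  : ∀ {Γ u A B} → Γ ⊢ u ∶ B → Γ ⊢ inj1 A u ∶ A ∨' B
  ⊢case  : ∀ {Γ u w₁ w₂ A B C} → Γ ⊢ u ∶ A ∨' B → (A ∷ Γ) ⊢ w₁ ∶ C →
           (B ∷ Γ) ⊢ w₂ ∶ C → Γ ⊢ u · case A B w₁ w₂ ∶ C
  ⊢allE  : ∀ {Γ u A m} → Γ ⊢ u ∶ ∀' A → Γ ⊢ u · argT m ∶ A [ m ]F
  -- eigenvariable condition: α (individual 0) does not occur in Γ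
  ⊢allI  : ∀ {Γ u A} → map shiftF Γ ⊢ u ∶ A → Γ ⊢ Lam u ∶ ∀' A
  ⊢exI   : ∀ {Γ u A m} → Γ ⊢ u ∶ A [ m ]F → Γ ⊢ wit A m u ∶ ∃' A
  -- eigenvariable condition: α does not occur in Γ nor in C
  ⊢exE   : ∀ {Γ u t A C} → Γ ⊢ u ∶ ∃' A → (A ∷ map shiftF Γ) ⊢ t ∶ shiftF C →
           Γ ⊢ u · exE A t ∶ C
  ⊢par   : ∀ {Γ u v A B C} → ((A ⇒ B) ∷ Γ) ⊢ u ∶ C → ((B ⇒ A) ∷ Γ) ⊢ v ∶ C →
           Γ ⊢ par A B u v ∶ C
  ⊢efq   : ∀ {Γ u P} → Atomic P → Γ ⊢ u ∶ ⊥' → Γ ⊢ efq P u ∶ P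
  ⊢abort : ∀ {Γ A B} → Γ ⊢ abort A B ∶ A ⇒ B

-- stack elements ξ admitted in (u ∥_a v) ξ ↦ u ξ ∥_a v ξ
data ParArg : Elim → Set where
  pArgP : ∀ u → ParArg (argP u)
  pPrj0 : ParArg prj0
  pPrj1 : ParArg prj1
  pCase : ∀ A B w₁ w₂ → ParArg (case A B w₁ w₂)
  pExE  : ∀ A w → ParArg (exE A w)

data Contr : PT → Elim → PT → Set where
  βλ   : ∀ {A u t} → Contr (lam A u) (argP t) (sub1 t u)
  β∀   : ∀ {u m} → Contr (Lam u) (argT m) (isub1 m u)
  βπ0  : ∀ {u₀ u₁} → Contr (pair u₀ u₁) prj0 u₀
  βπ1  : ∀ {u₀ u₁} → Contr (pair u₀ u₁) prj1 u₁
  βι0  : ∀ {B u A' B' w₀ w₁} → Contr (inj0 B u) (case A' B' w₀ w₁) (sub1 u w₀)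
  βι1  : ∀ {A u A' B' w₀ w₁} → Contr (inj1 A u) (case A' B' w₀ w₁) (sub1 u w₁)
  β∃   : ∀ {A m u A' v} → Contr (wit A m u) (exE A' v) (sub1 u (isub1 m v))
  ∥ξ   : ∀ {A B u v ξ} → ParArg ξ →
         Contr (par A B u v) ξ (par A B (u · renE suc ξ) (v · renE suc ξ))

data ProcStep (Γ : List Fm) : PT → PT → Set where
  basic  : ∀ {r ξ h σ} → Contr r ξ h → ProcStep Γ ((r · ξ) ◂ σ) (h ◂ σ)
  abortS : ∀ {A B u σ D} → Γ ⊢ (abort A B · argP u) ◂ σ ∶ D → Γ ⊢ u ∶ D →
           ProcStep Γ ((abort A B · argP u) ◂ σ) u

data PCtx : Set where
  hole : PCtx
  inL  : Fm → Fm → PCtx → PT → PCtx    -- C ∥_a v  (a : A→B in C)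
  inR  : Fm → Fm → PT → PCtx → PCtx    -- u ∥_a C  (a : B→A in C)

plug : PCtx → PT → PT
plug hole p            = p
plug (inL A B C v) p   = par A B (plug C p) v
plug (inR A B u C) p   = par A B u (plug C p)

holeCtx : PCtx → List Fm → List Fm
holeCtx hole Γ          = Γ
holeCtx (inL A B C v) Γ = holeCtx C ((A ⇒ B) ∷ Γ)
holeCtx (inR A B u C) Γ = holeCtx C ((B ⇒ A) ∷ Γ)

depth : PCtx → ℕ
depth hole          = 0
depth (inL _ _ C _) = suc (depth C)
depth (inR _ _ _ C) = suc (depth C)

nproc : PT → ℕ
nproc (par _ _ u v) = nproc u + nproc v
nproc _             = 1

-- index (from the left, starting at 0) of the process at the hole
left : PCtx → ℕ
left hole          = 0
left (inL _ _ C _) = left C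
left (inR _ _ u C) = nproc u + left C

-- the ∥-bound variable (index 0 outside C) heads an elementary process
-- a s ρ sitting at the hole of C
AHeaded : PT → PCtx → PT → List Elim → Set
AHeaded u C s ρ = u ≡ plug C ((pv (depth C) · argP s) ◂ ρ)

Leftmost : PT → PCtx → PT → List Elim → Set
Leftmost u C s ρ = AHeaded u C s ρ ×
  (∀ C' s' ρ' → AHeaded u C' s' ρ' → left C ≤ left C')

-- v[λy^D s / a] put at the hole of a parallel context of depth k
-- (v has a as variable 0 and lives outside the context)
crossSub : Fm → PT → PT → ℕ → PT
crossSub D v s k = substP σ v
  where
  σ : ℕ → PT
  σ zero    = lam D (renP suc s)
  σ (suc i) = pv (k + suc i)

-- Head redexes of t (typed in Γ): Redex Γ t n t' means that t has a
-- head redex whose starting symbol lies in the n-th parallel process of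
-- t and whose contraction yields t'.

data Redex (Γ : List Fm) (t : PT) : ℕ → PT → Set where
  internal : ∀ C p p' → t ≡ plug C p → ProcStep (holeCtx C Γ) p p' →
             Redex Γ t (left C) (plug C p')
  crossL   : ∀ C A B u v D s ρ → t ≡ plug C (par A B u v) → Leftmost u D s ρ →
             Redex Γ t (left C + left D)
               (plug C (par A B (plug D (crossSub B v s (depth D))) v))
  crossR   : ∀ C A B u v D s ρ → t ≡ plug C (par A B u v) →
             (∀ D' s' ρ' → ¬ (AHeaded u D' s' ρ')) → Leftmost v D s ρ →
             Redex Γ t (left C + nproc u + left D)
               (plug C (par A B u (plug D (crossSub A u s (depth D)))))

-- one step of head reduction: contract the head redex whose starting
-- symbol is leftmost
_⊢_≻_ : List Fm → PT → PT → Set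
Γ ⊢ t ≻ t' = Σ ℕ λ n → Redex Γ t n t' × (∀ m t'' → Redex Γ t m t'' → n ≤ m)

_⊢_≻⁺_ : List Fm → PT → PT → Set
Γ ⊢ t ≻⁺ t' = TransClosure (Γ ⊢_≻_) t t'

infix 2 _⊢_≻_ _⊢_≻⁺_

-- The terms of Proposition 3.6 (in scope Γ; u, v have a as variable 0)

scrA : Fm → Fm → Fm → PT → PT
scrA A B C v = lam A (abort C B · argP (substP σ v))
  where
  σ : ℕ → PT
  σ zero    = lam B (pv 1)     -- λy^B x   (y = 0, x = 1)
  σ (suc i) = pv (suc i)

scrB : Fm → Fm → Fm → PT → PT
scrB A B C u = lam B (abort C A · argP (substP σ u))
  where
  σ : ℕ → PT
  σ zero    = lam A (pv 1)
  σ (suc i) = pv (suc i)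

-- Write σ for [𝒜/a].  It sends a to an abstraction and every other variable to a
-- variable, so it creates no parallel processes and preserves the shape of elementary
-- processes: every head redex of u[σ] is the image of a head redex of u, or comes from
-- a process a s ρ of u, which σ turns into the β-redex 𝒜 s ρ, in the same parallel
-- process.  Hence the head redex of u ∥ v, when it acts on u, is mirrored by the head
-- redex of u[σ]: an internal or cross reduction inside u by one step of u[σ], and the
-- outer cross reduction at the leftmost a-headed process a s ρ of u by the β-step to
-- 𝒜 (v[λy.s/a]) ρ followed by the abort step to v[λy.s/a].  A head step acting on the
-- other side changes that side, because no contraction of a typed redex reproduces it.

module Submission where

open import Defs
open import Data.Empty using (⊥; ⊥-elim)
open import Data.List using (List; []; _∷_; map; _++_)
open import Data.List.Properties using (++-identityʳ; ++-assoc)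
open import Data.Nat using (ℕ; zero; suc; _+_; _≤_; _<_; _≮_; z≤n; s≤s; _≟_; _<?_)
open import Data.Nat.Properties using (≤-refl; ≤-trans; <-trans; <-irrefl; ≤-<-trans; <-≤-trans; <⇒≤; <⇒≱; ≮⇒≥; n≮n; n≤1+n; m≤m+n; m≤n+m; m+1+n≢m; +-suc; +-assoc; +-identityʳ; +-mono-≤; +-monoʳ-≤; +-monoʳ-<; +-cancelˡ-≤; +-cancelˡ-<)
open import Data.Product using (Σ; _×_; _,_; proj₁; proj₂)
open import Data.Sum using (_⊎_; inj₁; inj₂)
open import Data.Unit using (⊤; tt)
open import Function using (_∘_)
open import Relation.Binary.Construct.Closure.Transitive using ([_]; _∷_)
open import Relation.Binary.PropositionalEquality
open import Relation.Nullary using (¬_; yes; no; contradiction)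
open ≡-Reasoning

cong₃ : ∀ {A B C D : Set} (f : A → B → C → D) {a a' b b' c c'} → a ≡ a' → b ≡ b' → c ≡ c' → f a b c ≡ f a' b' c'
cong₃ f refl refl refl = refl

cong₄ : ∀ {A B C D E : Set} (f : A → B → C → D → E) {a a' b b' c c' d d'} → a ≡ a' → b ≡ b' → c ≡ c' → d ≡ d' → f a b c d ≡ f a' b' c' d'
cong₄ f refl refl refl refl = refl

-- Substitution lemmas

shiftσ : ℕ → Tm
shiftσ i = ivar (suc i)

mutual
  substT-cong : ∀ {σ τ} → σ ≗ τ → ∀ m → substT σ m ≡ substT τ m
  substT-cong e (ivar i) = e i
  substT-cong e (const c) = refl
  substT-cong e (fn f ms) = cong (fn f) (substTs-cong e ms)

  substTs-cong : ∀ {σ τ} → σ ≗ τ → ∀ ms → substTs σ ms ≡ substTs τ ms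
  substTs-cong e [] = refl
  substTs-cong e (m ∷ ms) = cong₂ _∷_ (substT-cong e m) (substTs-cong e ms)

mutual
  renT≡substT : ∀ f m → renT f m ≡ substT (λ i → ivar (f i)) m
  renT≡substT f (ivar i) = refl
  renT≡substT f (const c) = refl
  renT≡substT f (fn g ms) = cong (fn g) (renTs≡substTs f ms)

  renTs≡substTs : ∀ f ms → renTs f ms ≡ substTs (λ i → ivar (f i)) ms
  renTs≡substTs f [] = refl
  renTs≡substTs f (m ∷ ms) = cong₂ _∷_ (renT≡substT f m) (renTs≡substTs f ms)

mutual
  substT-id : ∀ m → substT ivar m ≡ m
  substT-id (ivar i) = refl
  substT-id (const c) = refl
  substT-id (fn f ms) = cong (fn f) (substTs-id ms)

  substTs-id : ∀ ms → substTs ivar ms ≡ ms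
  substTs-id [] = refl
  substTs-id (m ∷ ms) = cong₂ _∷_ (substT-id m) (substTs-id ms)

mutual
  substT-∘ : ∀ σ τ m → substT τ (substT σ m) ≡ substT (λ i → substT τ (σ i)) m
  substT-∘ σ τ (ivar i) = refl
  substT-∘ σ τ (const c) = refl
  substT-∘ σ τ (fn f ms) = cong (fn f) (substTs-∘ σ τ ms)

  substTs-∘ : ∀ σ τ ms → substTs τ (substTs σ ms) ≡ substTs (λ i → substT τ (σ i)) ms
  substTs-∘ σ τ [] = refl
  substTs-∘ σ τ (m ∷ ms) = cong₂ _∷_ (substT-∘ σ τ m) (substTs-∘ σ τ ms)

liftT-cong : ∀ {σ τ} → σ ≗ τ → liftT σ ≗ liftT τ
liftT-cong e zero = refl
liftT-cong e (suc i) = cong (renT suc) (e i)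

liftT-id : liftT ivar ≗ ivar
liftT-id zero = refl
liftT-id (suc i) = refl

liftT-∘ : ∀ σ τ → (λ i → substT (liftT τ) (liftT σ i)) ≗ liftT (λ i → substT τ (σ i))
liftT-∘ σ τ zero = refl
liftT-∘ σ τ (suc i) =
  trans (cong (substT (liftT τ)) (renT≡substT suc (σ i)))
  (trans (substT-∘ shiftσ (liftT τ) (σ i))
  (trans (substT-cong (λ j → renT≡substT suc (τ j)) (σ i))
  (trans (sym (substT-∘ τ shiftσ (σ i)))
  (sym (renT≡substT suc (substT τ (σ i)))))))

substF-cong : ∀ {σ τ} → σ ≗ τ → ∀ A → substF σ A ≡ substF τ A
substF-cong e (atom p ms) = cong (atom p) (substTs-cong e ms)
substF-cong e ⊥' = refl
substF-cong e (A ∧' B) = cong₂ _∧'_ (substF-cong e A) (substF-cong e B)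
substF-cong e (A ∨' B) = cong₂ _∨'_ (substF-cong e A) (substF-cong e B)
substF-cong e (A ⇒ B) = cong₂ _⇒_ (substF-cong e A) (substF-cong e B)
substF-cong e (∀' A) = cong ∀' (substF-cong (liftT-cong e) A)
substF-cong e (∃' A) = cong ∃' (substF-cong (liftT-cong e) A)

substF-id : ∀ A → substF ivar A ≡ A
substF-id (atom p ms) = cong (atom p) (substTs-id ms)
substF-id ⊥' = refl
substF-id (A ∧' B) = cong₂ _∧'_ (substF-id A) (substF-id B)
substF-id (A ∨' B) = cong₂ _∨'_ (substF-id A) (substF-id B)
substF-id (A ⇒ B) = cong₂ _⇒_ (substF-id A) (substF-id B)
substF-id (∀' A) = cong ∀' (trans (substF-cong liftT-id A) (substF-id A))
substF-id (∃' A) = cong ∃' (trans (substF-cong liftT-id A) (substF-id A))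

substF-∘ : ∀ σ τ A → substF τ (substF σ A) ≡ substF (λ i → substT τ (σ i)) A
substF-∘ σ τ (atom p ms) = cong (atom p) (substTs-∘ σ τ ms)
substF-∘ σ τ ⊥' = refl
substF-∘ σ τ (A ∧' B) = cong₂ _∧'_ (substF-∘ σ τ A) (substF-∘ σ τ B)
substF-∘ σ τ (A ∨' B) = cong₂ _∨'_ (substF-∘ σ τ A) (substF-∘ σ τ B)
substF-∘ σ τ (A ⇒ B) = cong₂ _⇒_ (substF-∘ σ τ A) (substF-∘ σ τ B)
substF-∘ σ τ (∀' A) = cong ∀' (trans (substF-∘ (liftT σ) (liftT τ) A) (substF-cong (liftT-∘ σ τ) A))
substF-∘ σ τ (∃' A) = cong ∃' (trans (substF-∘ (liftT σ) (liftT τ) A) (substF-cong (liftT-∘ σ τ) A))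

substF-[]F : ∀ ρ A m → substF ρ (A [ m ]F) ≡ (substF (liftT ρ) A) [ substT ρ m ]F
substF-[]F ρ A m = trans (substF-∘ (consT m) ρ A)
  (trans (substF-cong e A) (sym (substF-∘ (liftT ρ) (consT (substT ρ m)) A)))
  where
  e : ∀ i → substT ρ (consT m i) ≡ substT (consT (substT ρ m)) (liftT ρ i)
  e zero = refl
  e (suc i) = sym (trans (cong (substT (consT (substT ρ m))) (renT≡substT suc (ρ i)))
     (trans (substT-∘ shiftσ (consT (substT ρ m)) (ρ i)) (substT-id (ρ i))))

substF-liftT-shiftF : ∀ ρ C → substF (liftT ρ) (shiftF C) ≡ shiftF (substF ρ C)
substF-liftT-shiftF ρ C = trans (substF-∘ shiftσ (liftT ρ) C)
  (trans (substF-cong (λ i → renT≡substT suc (ρ i)) C) (sym (substF-∘ ρ shiftσ C)))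

map-substF-liftT-shiftF : ∀ ρ Γ → map (substF (liftT ρ)) (map shiftF Γ) ≡ map shiftF (map (substF ρ) Γ)
map-substF-liftT-shiftF ρ [] = refl
map-substF-liftT-shiftF ρ (C ∷ Γ) = cong₂ _∷_ (substF-liftT-shiftF ρ C) (map-substF-liftT-shiftF ρ Γ)

shiftF-injective : ∀ {A B} → shiftF A ≡ shiftF B → A ≡ B
shiftF-injective {A} {B} e = trans (sym (unshift A)) (trans (cong (substF predT) e) (unshift B))
  where
  predT : ℕ → Tm
  predT zero = ivar zero
  predT (suc i) = ivar i
  unshift : ∀ X → substF predT (shiftF X) ≡ X
  unshift X = trans (substF-∘ shiftσ predT X) (substF-id X)

_⨾_ : (ℕ → PT) → (ℕ → PT) → ℕ → PT
(σ ⨾ τ) i = substP τ (σ i)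

liftP-cong : ∀ {σ τ} → σ ≗ τ → liftP σ ≗ liftP τ
liftP-cong e zero = refl
liftP-cong e (suc i) = cong (renP suc) (e i)

liftPI-cong : ∀ {σ τ} → σ ≗ τ → liftPI σ ≗ liftPI τ
liftPI-cong e i = cong shiftIP (e i)

mutual
  substP-cong : ∀ {σ τ} → σ ≗ τ → ∀ t → substP σ t ≡ substP τ t
  substP-cong e (pv i) = e i
  substP-cong e (t · ξ) = cong₂ _·_ (substP-cong e t) (substE-cong e ξ)
  substP-cong e (pair u t) = cong₂ pair (substP-cong e u) (substP-cong e t)
  substP-cong e (lam A u) = cong (lam A) (substP-cong (liftP-cong e) u)
  substP-cong e (inj0 B u) = cong (inj0 B) (substP-cong e u)
  substP-cong e (inj1 A u) = cong (inj1 A) (substP-cong e u)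
  substP-cong e (Lam u) = cong Lam (substP-cong (liftPI-cong e) u)
  substP-cong e (wit A m u) = cong (wit A m) (substP-cong e u)
  substP-cong e (par A B u v) = cong₂ (par A B) (substP-cong (liftP-cong e) u) (substP-cong (liftP-cong e) v)
  substP-cong e (efq P u) = cong (efq P) (substP-cong e u)
  substP-cong e (abort A B) = refl

  substE-cong : ∀ {σ τ} → σ ≗ τ → ∀ ξ → substE σ ξ ≡ substE τ ξ
  substE-cong e (argP u) = cong argP (substP-cong e u)
  substE-cong e (argT m) = refl
  substE-cong e prj0 = refl
  substE-cong e prj1 = refl
  substE-cong e (case A B w₁ w₂) = cong₂ (case A B) (substP-cong (liftP-cong e) w₁) (substP-cong (liftP-cong e) w₂)
  substE-cong e (exE A w) = cong (exE A) (substP-cong (liftP-cong (liftPI-cong e)) w)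

mutual
  substIP-cong : ∀ {σ τ} → σ ≗ τ → ∀ t → substIP σ t ≡ substIP τ t
  substIP-cong e (pv i) = refl
  substIP-cong e (t · ξ) = cong₂ _·_ (substIP-cong e t) (substIE-cong e ξ)
  substIP-cong e (pair u t) = cong₂ pair (substIP-cong e u) (substIP-cong e t)
  substIP-cong e (lam A u) = cong₂ lam (substF-cong e A) (substIP-cong e u)
  substIP-cong e (inj0 B u) = cong₂ inj0 (substF-cong e B) (substIP-cong e u)
  substIP-cong e (inj1 A u) = cong₂ inj1 (substF-cong e A) (substIP-cong e u)
  substIP-cong e (Lam u) = cong Lam (substIP-cong (liftT-cong e) u)
  substIP-cong e (wit A m u) = cong₃ wit (substF-cong (liftT-cong e) A) (substT-cong e m) (substIP-cong e u)
  substIP-cong e (par A B u v) = cong₄ par (substF-cong e A) (substF-cong e B) (substIP-cong e u) (substIP-cong e v)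
  substIP-cong e (efq P u) = cong₂ efq (substF-cong e P) (substIP-cong e u)
  substIP-cong e (abort A B) = cong₂ abort (substF-cong e A) (substF-cong e B)

  substIE-cong : ∀ {σ τ} → σ ≗ τ → ∀ ξ → substIE σ ξ ≡ substIE τ ξ
  substIE-cong e (argP u) = cong argP (substIP-cong e u)
  substIE-cong e (argT m) = cong argT (substT-cong e m)
  substIE-cong e prj0 = refl
  substIE-cong e prj1 = refl
  substIE-cong e (case A B w₁ w₂) = cong₄ case (substF-cong e A) (substF-cong e B) (substIP-cong e w₁) (substIP-cong e w₂)
  substIE-cong e (exE A w) = cong₂ exE (substF-cong (liftT-cong e) A) (substIP-cong (liftT-cong e) w)

liftR-as-liftP : ∀ ρ → (λ i → pv (liftR ρ i)) ≗ liftP (λ i → pv (ρ i))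
liftR-as-liftP ρ zero = refl
liftR-as-liftP ρ (suc i) = refl

liftR-as-liftP-liftPI : ∀ ρ → (λ i → pv (liftR ρ i)) ≗ liftP (liftPI (λ i → pv (ρ i)))
liftR-as-liftP-liftPI ρ zero = refl
liftR-as-liftP-liftPI ρ (suc i) = refl

mutual
  renP≡substP : ∀ ρ t → renP ρ t ≡ substP (λ i → pv (ρ i)) t
  renP≡substP ρ (pv i) = refl
  renP≡substP ρ (t · ξ) = cong₂ _·_ (renP≡substP ρ t) (renE≡substE ρ ξ)
  renP≡substP ρ (pair u t) = cong₂ pair (renP≡substP ρ u) (renP≡substP ρ t)
  renP≡substP ρ (lam A u) = cong (lam A) (trans (renP≡substP (liftR ρ) u) (substP-cong (liftR-as-liftP ρ) u))
  renP≡substP ρ (inj0 B u) = cong (inj0 B) (renP≡substP ρ u)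
  renP≡substP ρ (inj1 A u) = cong (inj1 A) (renP≡substP ρ u)
  renP≡substP ρ (Lam u) = cong Lam (renP≡substP ρ u)
  renP≡substP ρ (wit A m u) = cong (wit A m) (renP≡substP ρ u)
  renP≡substP ρ (par A B u v) = cong₂ (par A B) (trans (renP≡substP (liftR ρ) u) (substP-cong (liftR-as-liftP ρ) u))
                                              (trans (renP≡substP (liftR ρ) v) (substP-cong (liftR-as-liftP ρ) v))
  renP≡substP ρ (efq P u) = cong (efq P) (renP≡substP ρ u)
  renP≡substP ρ (abort A B) = refl

  renE≡substE : ∀ ρ ξ → renE ρ ξ ≡ substE (λ i → pv (ρ i)) ξ
  renE≡substE ρ (argP u) = cong argP (renP≡substP ρ u)
  renE≡substE ρ (argT m) = refl
  renE≡substE ρ prj0 = refl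
  renE≡substE ρ prj1 = refl
  renE≡substE ρ (case A B w₁ w₂) = cong₂ (case A B) (trans (renP≡substP (liftR ρ) w₁) (substP-cong (liftR-as-liftP ρ) w₁))
                                                   (trans (renP≡substP (liftR ρ) w₂) (substP-cong (liftR-as-liftP ρ) w₂))
  renE≡substE ρ (exE A w) = cong (exE A) (trans (renP≡substP (liftR ρ) w) (substP-cong (liftR-as-liftP-liftPI ρ) w))

liftP-liftR : ∀ σ ρ → (λ i → liftP σ (liftR ρ i)) ≗ liftP (λ i → σ (ρ i))
liftP-liftR σ ρ zero = refl
liftP-liftR σ ρ (suc i) = refl

liftP-liftPI-liftR : ∀ σ ρ → (λ i → liftP (liftPI σ) (liftR ρ i)) ≗ liftP (liftPI (λ i → σ (ρ i)))
liftP-liftPI-liftR σ ρ zero = refl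
liftP-liftPI-liftR σ ρ (suc i) = refl

mutual
  substP-renP : ∀ σ ρ t → substP σ (renP ρ t) ≡ substP (λ i → σ (ρ i)) t
  substP-renP σ ρ (pv i) = refl
  substP-renP σ ρ (t · ξ) = cong₂ _·_ (substP-renP σ ρ t) (substE-renE σ ρ ξ)
  substP-renP σ ρ (pair u t) = cong₂ pair (substP-renP σ ρ u) (substP-renP σ ρ t)
  substP-renP σ ρ (lam A u) = cong (lam A) (trans (substP-renP (liftP σ) (liftR ρ) u) (substP-cong (liftP-liftR σ ρ) u))
  substP-renP σ ρ (inj0 B u) = cong (inj0 B) (substP-renP σ ρ u)
  substP-renP σ ρ (inj1 A u) = cong (inj1 A) (substP-renP σ ρ u)
  substP-renP σ ρ (Lam u) = cong Lam (substP-renP (liftPI σ) ρ u)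
  substP-renP σ ρ (wit A m u) = cong (wit A m) (substP-renP σ ρ u)
  substP-renP σ ρ (par A B u v) = cong₂ (par A B) (trans (substP-renP (liftP σ) (liftR ρ) u) (substP-cong (liftP-liftR σ ρ) u))
                                         (trans (substP-renP (liftP σ) (liftR ρ) v) (substP-cong (liftP-liftR σ ρ) v))
  substP-renP σ ρ (efq P u) = cong (efq P) (substP-renP σ ρ u)
  substP-renP σ ρ (abort A B) = refl

  substE-renE : ∀ σ ρ ξ → substE σ (renE ρ ξ) ≡ substE (λ i → σ (ρ i)) ξ
  substE-renE σ ρ (argP u) = cong argP (substP-renP σ ρ u)
  substE-renE σ ρ (argT m) = refl
  substE-renE σ ρ prj0 = refl
  substE-renE σ ρ prj1 = refl
  substE-renE σ ρ (case A B w₁ w₂) = cong₂ (case A B) (trans (substP-renP (liftP σ) (liftR ρ) w₁) (substP-cong (liftP-liftR σ ρ) w₁))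
                                                (trans (substP-renP (liftP σ) (liftR ρ) w₂) (substP-cong (liftP-liftR σ ρ) w₂))
  substE-renE σ ρ (exE A w) = cong (exE A) (trans (substP-renP (liftP (liftPI σ)) (liftR ρ) w) (substP-cong (liftP-liftPI-liftR σ ρ) w))

renP-∘ : ∀ f g t → renP f (renP g t) ≡ renP (λ i → f (g i)) t
renP-∘ f g t = trans (renP≡substP f (renP g t)) (trans (substP-renP _ g t) (sym (renP≡substP _ t)))

mutual
  renP-substIP : ∀ f ρ t → renP f (substIP ρ t) ≡ substIP ρ (renP f t)
  renP-substIP f ρ (pv i) = refl
  renP-substIP f ρ (t · ξ) = cong₂ _·_ (renP-substIP f ρ t) (renE-substIE f ρ ξ)
  renP-substIP f ρ (pair u t) = cong₂ pair (renP-substIP f ρ u) (renP-substIP f ρ t)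
  renP-substIP f ρ (lam A u) = cong (lam _) (renP-substIP (liftR f) ρ u)
  renP-substIP f ρ (inj0 B u) = cong (inj0 _) (renP-substIP f ρ u)
  renP-substIP f ρ (inj1 A u) = cong (inj1 _) (renP-substIP f ρ u)
  renP-substIP f ρ (Lam u) = cong Lam (renP-substIP f (liftT ρ) u)
  renP-substIP f ρ (wit A m u) = cong (wit _ _) (renP-substIP f ρ u)
  renP-substIP f ρ (par A B u v) = cong₂ (par _ _) (renP-substIP (liftR f) ρ u) (renP-substIP (liftR f) ρ v)
  renP-substIP f ρ (efq P u) = cong (efq _) (renP-substIP f ρ u)
  renP-substIP f ρ (abort A B) = refl

  renE-substIE : ∀ f ρ ξ → renE f (substIE ρ ξ) ≡ substIE ρ (renE f ξ)
  renE-substIE f ρ (argP u) = cong argP (renP-substIP f ρ u)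
  renE-substIE f ρ (argT m) = refl
  renE-substIE f ρ prj0 = refl
  renE-substIE f ρ prj1 = refl
  renE-substIE f ρ (case A B w₁ w₂) = cong₂ (case _ _) (renP-substIP (liftR f) ρ w₁) (renP-substIP (liftR f) ρ w₂)
  renE-substIE f ρ (exE A w) = cong (exE _) (renP-substIP (liftR f) (liftT ρ) w)

mutual
  substIP-∘ : ∀ ρ1 ρ2 t → substIP ρ2 (substIP ρ1 t) ≡ substIP (λ i → substT ρ2 (ρ1 i)) t
  substIP-∘ ρ1 ρ2 (pv i) = refl
  substIP-∘ ρ1 ρ2 (t · ξ) = cong₂ _·_ (substIP-∘ ρ1 ρ2 t) (substIE-∘ ρ1 ρ2 ξ)
  substIP-∘ ρ1 ρ2 (pair u t) = cong₂ pair (substIP-∘ ρ1 ρ2 u) (substIP-∘ ρ1 ρ2 t)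
  substIP-∘ ρ1 ρ2 (lam A u) = cong₂ lam (substF-∘ ρ1 ρ2 A) (substIP-∘ ρ1 ρ2 u)
  substIP-∘ ρ1 ρ2 (inj0 B u) = cong₂ inj0 (substF-∘ ρ1 ρ2 B) (substIP-∘ ρ1 ρ2 u)
  substIP-∘ ρ1 ρ2 (inj1 A u) = cong₂ inj1 (substF-∘ ρ1 ρ2 A) (substIP-∘ ρ1 ρ2 u)
  substIP-∘ ρ1 ρ2 (Lam u) = cong Lam (trans (substIP-∘ (liftT ρ1) (liftT ρ2) u) (substIP-cong (liftT-∘ ρ1 ρ2) u))
  substIP-∘ ρ1 ρ2 (wit A m u) = cong₃ wit (trans (substF-∘ (liftT ρ1) (liftT ρ2) A) (substF-cong (liftT-∘ ρ1 ρ2) A))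
                                   (substT-∘ ρ1 ρ2 m) (substIP-∘ ρ1 ρ2 u)
  substIP-∘ ρ1 ρ2 (par A B u v) = cong₄ par (substF-∘ ρ1 ρ2 A) (substF-∘ ρ1 ρ2 B) (substIP-∘ ρ1 ρ2 u) (substIP-∘ ρ1 ρ2 v)
  substIP-∘ ρ1 ρ2 (efq P u) = cong₂ efq (substF-∘ ρ1 ρ2 P) (substIP-∘ ρ1 ρ2 u)
  substIP-∘ ρ1 ρ2 (abort A B) = cong₂ abort (substF-∘ ρ1 ρ2 A) (substF-∘ ρ1 ρ2 B)

  substIE-∘ : ∀ ρ1 ρ2 ξ → substIE ρ2 (substIE ρ1 ξ) ≡ substIE (λ i → substT ρ2 (ρ1 i)) ξ
  substIE-∘ ρ1 ρ2 (argP u) = cong argP (substIP-∘ ρ1 ρ2 u)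
  substIE-∘ ρ1 ρ2 (argT m) = cong argT (substT-∘ ρ1 ρ2 m)
  substIE-∘ ρ1 ρ2 prj0 = refl
  substIE-∘ ρ1 ρ2 prj1 = refl
  substIE-∘ ρ1 ρ2 (case A B w₁ w₂) = cong₄ case (substF-∘ ρ1 ρ2 A) (substF-∘ ρ1 ρ2 B) (substIP-∘ ρ1 ρ2 w₁) (substIP-∘ ρ1 ρ2 w₂)
  substIE-∘ ρ1 ρ2 (exE A w) = cong₂ exE (trans (substF-∘ (liftT ρ1) (liftT ρ2) A) (substF-cong (liftT-∘ ρ1 ρ2) A))
                                  (trans (substIP-∘ (liftT ρ1) (liftT ρ2) w) (substIP-cong (liftT-∘ ρ1 ρ2) w))

mutual
  substIP-id : ∀ t → substIP ivar t ≡ t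
  substIP-id (pv i) = refl
  substIP-id (t · ξ) = cong₂ _·_ (substIP-id t) (substIE-id ξ)
  substIP-id (pair u t) = cong₂ pair (substIP-id u) (substIP-id t)
  substIP-id (lam A u) = cong₂ lam (substF-id A) (substIP-id u)
  substIP-id (inj0 B u) = cong₂ inj0 (substF-id B) (substIP-id u)
  substIP-id (inj1 A u) = cong₂ inj1 (substF-id A) (substIP-id u)
  substIP-id (Lam u) = cong Lam (trans (substIP-cong liftT-id u) (substIP-id u))
  substIP-id (wit A m u) = cong₃ wit (trans (substF-cong liftT-id A) (substF-id A)) (substT-id m) (substIP-id u)
  substIP-id (par A B u v) = cong₄ par (substF-id A) (substF-id B) (substIP-id u) (substIP-id v)
  substIP-id (efq P u) = cong₂ efq (substF-id P) (substIP-id u)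
  substIP-id (abort A B) = cong₂ abort (substF-id A) (substF-id B)

  substIE-id : ∀ ξ → substIE ivar ξ ≡ ξ
  substIE-id (argP u) = cong argP (substIP-id u)
  substIE-id (argT m) = cong argT (substT-id m)
  substIE-id prj0 = refl
  substIE-id prj1 = refl
  substIE-id (case A B w₁ w₂) = cong₄ case (substF-id A) (substF-id B) (substIP-id w₁) (substIP-id w₂)
  substIE-id (exE A w) = cong₂ exE (trans (substF-cong liftT-id A) (substF-id A)) (trans (substIP-cong liftT-id w) (substIP-id w))

substIP-liftT-shiftIP : ∀ ρ x → substIP (liftT ρ) (shiftIP x) ≡ shiftIP (substIP ρ x)
substIP-liftT-shiftIP ρ x = trans (substIP-∘ shiftσ (liftT ρ) x) (trans (substIP-cong (λ i → renT≡substT suc (ρ i)) x) (sym (substIP-∘ ρ shiftσ x)))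

mutual
  substIP-substP : ∀ ρ σ t → substIP ρ (substP σ t) ≡ substP (λ i → substIP ρ (σ i)) (substIP ρ t)
  substIP-substP ρ σ (pv i) = refl
  substIP-substP ρ σ (t · ξ) = cong₂ _·_ (substIP-substP ρ σ t) (substIE-substE ρ σ ξ)
  substIP-substP ρ σ (pair u t) = cong₂ pair (substIP-substP ρ σ u) (substIP-substP ρ σ t)
  substIP-substP ρ σ (lam A u) = cong (lam _) (trans (substIP-substP ρ (liftP σ) u) (substP-cong (substIP-liftP ρ σ) (substIP ρ u)))
  substIP-substP ρ σ (inj0 B u) = cong (inj0 _) (substIP-substP ρ σ u)
  substIP-substP ρ σ (inj1 A u) = cong (inj1 _) (substIP-substP ρ σ u)
  substIP-substP ρ σ (Lam u) = cong Lam (trans (substIP-substP (liftT ρ) (liftPI σ) u) (substP-cong (λ i → substIP-liftT-shiftIP ρ (σ i)) (substIP (liftT ρ) u)))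
  substIP-substP ρ σ (wit A m u) = cong (wit _ _) (substIP-substP ρ σ u)
  substIP-substP ρ σ (par A B u v) = cong₂ (par _ _) (trans (substIP-substP ρ (liftP σ) u) (substP-cong (substIP-liftP ρ σ) (substIP ρ u)))
                                         (trans (substIP-substP ρ (liftP σ) v) (substP-cong (substIP-liftP ρ σ) (substIP ρ v)))
  substIP-substP ρ σ (efq P u) = cong (efq _) (substIP-substP ρ σ u)
  substIP-substP ρ σ (abort A B) = refl

  substIE-substE : ∀ ρ σ ξ → substIE ρ (substE σ ξ) ≡ substE (λ i → substIP ρ (σ i)) (substIE ρ ξ)
  substIE-substE ρ σ (argP u) = cong argP (substIP-substP ρ σ u)
  substIE-substE ρ σ (argT m) = refl
  substIE-substE ρ σ prj0 = refl
  substIE-substE ρ σ prj1 = refl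
  substIE-substE ρ σ (case A B w₁ w₂) = cong₂ (case _ _) (trans (substIP-substP ρ (liftP σ) w₁) (substP-cong (substIP-liftP ρ σ) (substIP ρ w₁)))
                                                (trans (substIP-substP ρ (liftP σ) w₂) (substP-cong (substIP-liftP ρ σ) (substIP ρ w₂)))
  substIE-substE ρ σ (exE A w) = cong (exE _) (trans (substIP-substP (liftT ρ) (liftP (liftPI σ)) w) (substP-cong e (substIP (liftT ρ) w)))
    where
    e : ∀ i → substIP (liftT ρ) (liftP (liftPI σ) i) ≡ liftP (liftPI (λ j → substIP ρ (σ j))) i
    e zero = refl
    e (suc i) = trans (sym (renP-substIP suc (liftT ρ) (shiftIP (σ i)))) (cong (renP suc) (substIP-liftT-shiftIP ρ (σ i)))

  substIP-liftP : ∀ ρ σ i → substIP ρ (liftP σ i) ≡ liftP (λ j → substIP ρ (σ j)) i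
  substIP-liftP ρ σ zero = refl
  substIP-liftP ρ σ (suc i) = sym (renP-substIP suc ρ (σ i))

mutual
  renP-substP : ∀ ρ σ t → renP ρ (substP σ t) ≡ substP (λ i → renP ρ (σ i)) t
  renP-substP ρ σ (pv i) = refl
  renP-substP ρ σ (t · ξ) = cong₂ _·_ (renP-substP ρ σ t) (renE-substE ρ σ ξ)
  renP-substP ρ σ (pair u t) = cong₂ pair (renP-substP ρ σ u) (renP-substP ρ σ t)
  renP-substP ρ σ (lam A u) = cong (lam A) (trans (renP-substP (liftR ρ) (liftP σ) u) (substP-cong (renP-liftP ρ σ) u))
  renP-substP ρ σ (inj0 B u) = cong (inj0 B) (renP-substP ρ σ u)
  renP-substP ρ σ (inj1 A u) = cong (inj1 A) (renP-substP ρ σ u)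
  renP-substP ρ σ (Lam u) = cong Lam (trans (renP-substP ρ (liftPI σ) u) (substP-cong (λ i → renP-substIP ρ shiftσ (σ i)) u))
  renP-substP ρ σ (wit A m u) = cong (wit A m) (renP-substP ρ σ u)
  renP-substP ρ σ (par A B u v) = cong₂ (par A B) (trans (renP-substP (liftR ρ) (liftP σ) u) (substP-cong (renP-liftP ρ σ) u))
                                         (trans (renP-substP (liftR ρ) (liftP σ) v) (substP-cong (renP-liftP ρ σ) v))
  renP-substP ρ σ (efq P u) = cong (efq P) (renP-substP ρ σ u)
  renP-substP ρ σ (abort A B) = refl

  renE-substE : ∀ ρ σ ξ → renE ρ (substE σ ξ) ≡ substE (λ i → renP ρ (σ i)) ξ
  renE-substE ρ σ (argP u) = cong argP (renP-substP ρ σ u)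
  renE-substE ρ σ (argT m) = refl
  renE-substE ρ σ prj0 = refl
  renE-substE ρ σ prj1 = refl
  renE-substE ρ σ (case A B w₁ w₂) = cong₂ (case A B) (trans (renP-substP (liftR ρ) (liftP σ) w₁) (substP-cong (renP-liftP ρ σ) w₁))
                                                (trans (renP-substP (liftR ρ) (liftP σ) w₂) (substP-cong (renP-liftP ρ σ) w₂))
  renE-substE ρ σ (exE A w) = cong (exE A) (trans (renP-substP (liftR ρ) (liftP (liftPI σ)) w) (substP-cong e w))
    where
    e : ∀ i → renP (liftR ρ) (liftP (liftPI σ) i) ≡ liftP (liftPI (λ j → renP ρ (σ j))) i
    e zero = refl
    e (suc i) = trans (renP-∘ (liftR ρ) suc (shiftIP (σ i)))
                (trans (sym (renP-∘ suc ρ (shiftIP (σ i)))) (cong (renP suc) (renP-substIP ρ shiftσ (σ i))))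

  renP-liftP : ∀ ρ σ i → renP (liftR ρ) (liftP σ i) ≡ liftP (λ j → renP ρ (σ j)) i
  renP-liftP ρ σ zero = refl
  renP-liftP ρ σ (suc i) = trans (renP-∘ (liftR ρ) suc (σ i)) (sym (renP-∘ suc ρ (σ i)))

liftP-⨾ : ∀ σ τ i → substP (liftP τ) (liftP σ i) ≡ liftP (σ ⨾ τ) i
liftP-⨾ σ τ zero = refl
liftP-⨾ σ τ (suc i) = trans (substP-renP (liftP τ) suc (σ i)) (sym (renP-substP suc τ (σ i)))

liftPI-⨾ : ∀ σ τ i → substP (liftPI τ) (liftPI σ i) ≡ liftPI (σ ⨾ τ) i
liftPI-⨾ σ τ i = sym (substIP-substP shiftσ τ (σ i))

mutual
  substP-∘ : ∀ σ τ t → substP τ (substP σ t) ≡ substP (σ ⨾ τ) t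
  substP-∘ σ τ (pv i) = refl
  substP-∘ σ τ (t · ξ) = cong₂ _·_ (substP-∘ σ τ t) (substE-∘ σ τ ξ)
  substP-∘ σ τ (pair u t) = cong₂ pair (substP-∘ σ τ u) (substP-∘ σ τ t)
  substP-∘ σ τ (lam A u) = cong (lam A) (trans (substP-∘ (liftP σ) (liftP τ) u) (substP-cong (liftP-⨾ σ τ) u))
  substP-∘ σ τ (inj0 B u) = cong (inj0 B) (substP-∘ σ τ u)
  substP-∘ σ τ (inj1 A u) = cong (inj1 A) (substP-∘ σ τ u)
  substP-∘ σ τ (Lam u) = cong Lam (trans (substP-∘ (liftPI σ) (liftPI τ) u) (substP-cong (liftPI-⨾ σ τ) u))
  substP-∘ σ τ (wit A m u) = cong (wit A m) (substP-∘ σ τ u)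
  substP-∘ σ τ (par A B u v) = cong₂ (par A B) (trans (substP-∘ (liftP σ) (liftP τ) u) (substP-cong (liftP-⨾ σ τ) u))
                                         (trans (substP-∘ (liftP σ) (liftP τ) v) (substP-cong (liftP-⨾ σ τ) v))
  substP-∘ σ τ (efq P u) = cong (efq P) (substP-∘ σ τ u)
  substP-∘ σ τ (abort A B) = refl

  substE-∘ : ∀ σ τ ξ → substE τ (substE σ ξ) ≡ substE (σ ⨾ τ) ξ
  substE-∘ σ τ (argP u) = cong argP (substP-∘ σ τ u)
  substE-∘ σ τ (argT m) = refl
  substE-∘ σ τ prj0 = refl
  substE-∘ σ τ prj1 = refl
  substE-∘ σ τ (case A B w₁ w₂) = cong₂ (case A B) (trans (substP-∘ (liftP σ) (liftP τ) w₁) (substP-cong (liftP-⨾ σ τ) w₁))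
                                                (trans (substP-∘ (liftP σ) (liftP τ) w₂) (substP-cong (liftP-⨾ σ τ) w₂))
  substE-∘ σ τ (exE A w) = cong (exE A) (trans (substP-∘ (liftP (liftPI σ)) (liftP (liftPI τ)) w)
     (substP-cong (λ i → trans (liftP-⨾ (liftPI σ) (liftPI τ) i) (liftP-cong (liftPI-⨾ σ τ) i)) w))

mutual
  substP-id : ∀ t → substP pv t ≡ t
  substP-id (pv i) = refl
  substP-id (t · ξ) = cong₂ _·_ (substP-id t) (substE-id ξ)
  substP-id (pair u t) = cong₂ pair (substP-id u) (substP-id t)
  substP-id (lam A u) = cong (lam A) (trans (substP-cong liftP-pv u) (substP-id u))
  substP-id (inj0 B u) = cong (inj0 B) (substP-id u)
  substP-id (inj1 A u) = cong (inj1 A) (substP-id u)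
  substP-id (Lam u) = cong Lam (substP-id u)
  substP-id (wit A m u) = cong (wit A m) (substP-id u)
  substP-id (par A B u v) = cong₂ (par A B) (trans (substP-cong liftP-pv u) (substP-id u)) (trans (substP-cong liftP-pv v) (substP-id v))
  substP-id (efq P u) = cong (efq P) (substP-id u)
  substP-id (abort A B) = refl

  substE-id : ∀ ξ → substE pv ξ ≡ ξ
  substE-id (argP u) = cong argP (substP-id u)
  substE-id (argT m) = refl
  substE-id prj0 = refl
  substE-id prj1 = refl
  substE-id (case A B w₁ w₂) = cong₂ (case A B) (trans (substP-cong liftP-pv w₁) (substP-id w₁)) (trans (substP-cong liftP-pv w₂) (substP-id w₂))
  substE-id (exE A w) = cong (exE A) (trans (substP-cong liftP-liftPI-pv w) (substP-id w))

  liftP-pv : liftP pv ≗ pv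
  liftP-pv zero = refl
  liftP-pv (suc i) = refl

  liftP-liftPI-pv : liftP (liftPI pv) ≗ pv
  liftP-liftPI-pv zero = refl
  liftP-liftPI-pv (suc i) = refl

-- Typing under renaming and substitution

∋-map : ∀ {Γ i A} (f : Fm → Fm) → Γ ∋ i ∶ A → map f Γ ∋ i ∶ f A
∋-map f here = here
∋-map f (there x) = there (∋-map f x)

∋-map⁻ : ∀ {Γ i B} (f : Fm → Fm) → map f Γ ∋ i ∶ B → Σ Fm λ A → (Γ ∋ i ∶ A) × (B ≡ f A)
∋-map⁻ {_ ∷ Γ} f here = _ , here , refl
∋-map⁻ {_ ∷ Γ} f (there x) with ∋-map⁻ f x
... | A , y , e = A , there y , e

∋-unique : ∀ {Γ i A B} → Γ ∋ i ∶ A → Γ ∋ i ∶ B → A ≡ B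
∋-unique here here = refl
∋-unique (there x) (there y) = ∋-unique x y

TypedRen : List Fm → List Fm → (ℕ → ℕ) → Set
TypedRen Γ Δ ρ = ∀ {i A} → Γ ∋ i ∶ A → Δ ∋ ρ i ∶ A

TypedRen-liftR : ∀ {Γ Δ ρ B} → TypedRen Γ Δ ρ → TypedRen (B ∷ Γ) (B ∷ Δ) (liftR ρ)
TypedRen-liftR r here = here
TypedRen-liftR r (there x) = there (r x)

TypedRen-shiftF : ∀ {Γ Δ ρ} → TypedRen Γ Δ ρ → TypedRen (map shiftF Γ) (map shiftF Δ) ρ
TypedRen-shiftF r x with ∋-map⁻ shiftF x
... | A , y , refl = ∋-map shiftF (r y)

⊢-renP : ∀ {Γ Δ ρ t A} → TypedRen Γ Δ ρ → Γ ⊢ t ∶ A → Δ ⊢ renP ρ t ∶ A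
⊢-renP r (⊢var x) = ⊢var (r x)
⊢-renP r (⊢pair d d₁) = ⊢pair (⊢-renP r d) (⊢-renP r d₁)
⊢-renP r (⊢π0 d) = ⊢π0 (⊢-renP r d)
⊢-renP r (⊢π1 d) = ⊢π1 (⊢-renP r d)
⊢-renP r (⊢app d d₁) = ⊢app (⊢-renP r d) (⊢-renP r d₁)
⊢-renP r (⊢lam d) = ⊢lam (⊢-renP (TypedRen-liftR r) d)
⊢-renP r (⊢inj0 d) = ⊢inj0 (⊢-renP r d)
⊢-renP r (⊢inj1 d) = ⊢inj1 (⊢-renP r d)
⊢-renP r (⊢case d d₁ d₂) = ⊢case (⊢-renP r d) (⊢-renP (TypedRen-liftR r) d₁) (⊢-renP (TypedRen-liftR r) d₂)
⊢-renP r (⊢allE d) = ⊢allE (⊢-renP r d)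
⊢-renP r (⊢allI d) = ⊢allI (⊢-renP (TypedRen-shiftF r) d)
⊢-renP r (⊢exI d) = ⊢exI (⊢-renP r d)
⊢-renP r (⊢exE d d₁) = ⊢exE (⊢-renP r d) (⊢-renP (TypedRen-liftR (TypedRen-shiftF r)) d₁)
⊢-renP r (⊢par d d₁) = ⊢par (⊢-renP (TypedRen-liftR r) d) (⊢-renP (TypedRen-liftR r) d₁)
⊢-renP r (⊢efq x d) = ⊢efq x (⊢-renP r d)
⊢-renP r ⊢abort = ⊢abort

⊢-weaken : ∀ {Γ t A B} → Γ ⊢ t ∶ A → (B ∷ Γ) ⊢ renP suc t ∶ A
⊢-weaken = ⊢-renP there

Atomic-substF : ∀ ρ {P} → Atomic P → Atomic (substF ρ P)
Atomic-substF ρ (atomA p ms) = atomA p _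
Atomic-substF ρ botA = botA

⊢-substIP : ∀ ρ {Γ t A} → Γ ⊢ t ∶ A → map (substF ρ) Γ ⊢ substIP ρ t ∶ substF ρ A
⊢-substIP ρ (⊢var x) = ⊢var (∋-map (substF ρ) x)
⊢-substIP ρ (⊢pair d d₁) = ⊢pair (⊢-substIP ρ d) (⊢-substIP ρ d₁)
⊢-substIP ρ (⊢π0 d) = ⊢π0 (⊢-substIP ρ d)
⊢-substIP ρ (⊢π1 d) = ⊢π1 (⊢-substIP ρ d)
⊢-substIP ρ (⊢app d d₁) = ⊢app (⊢-substIP ρ d) (⊢-substIP ρ d₁)
⊢-substIP ρ (⊢lam d) = ⊢lam (⊢-substIP ρ d)
⊢-substIP ρ (⊢inj0 d) = ⊢inj0 (⊢-substIP ρ d)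
⊢-substIP ρ (⊢inj1 d) = ⊢inj1 (⊢-substIP ρ d)
⊢-substIP ρ (⊢case d d₁ d₂) = ⊢case (⊢-substIP ρ d) (⊢-substIP ρ d₁) (⊢-substIP ρ d₂)
⊢-substIP ρ (⊢allE {A = A} {m = m} d) = subst (λ X → _ ⊢ _ ∶ X) (sym (substF-[]F ρ A m)) (⊢allE (⊢-substIP ρ d))
⊢-substIP ρ {Γ} (⊢allI d) = ⊢allI (subst (λ X → X ⊢ _ ∶ _) (map-substF-liftT-shiftF ρ Γ) (⊢-substIP (liftT ρ) d))
⊢-substIP ρ (⊢exI {A = A} {m = m} d) = ⊢exI (subst (λ X → _ ⊢ _ ∶ X) (substF-[]F ρ A m) (⊢-substIP ρ d))
⊢-substIP ρ {Γ} (⊢exE {A = A} {C = C} d d₁) = ⊢exE (⊢-substIP ρ d)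
  (subst₂ (λ X Y → (substF (liftT ρ) A ∷ X) ⊢ _ ∶ Y) (map-substF-liftT-shiftF ρ Γ) (substF-liftT-shiftF ρ C) (⊢-substIP (liftT ρ) d₁))
⊢-substIP ρ (⊢par d d₁) = ⊢par (⊢-substIP ρ d) (⊢-substIP ρ d₁)
⊢-substIP ρ (⊢efq x d) = ⊢efq (Atomic-substF ρ x) (⊢-substIP ρ d)
⊢-substIP ρ ⊢abort = ⊢abort

TypedSub : List Fm → List Fm → (ℕ → PT) → Set
TypedSub Γ Δ σ = ∀ {i A} → Γ ∋ i ∶ A → Δ ⊢ σ i ∶ A

TypedSub-liftP : ∀ {Γ Δ σ B} → TypedSub Γ Δ σ → TypedSub (B ∷ Γ) (B ∷ Δ) (liftP σ)
TypedSub-liftP s here = ⊢var here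
TypedSub-liftP s (there x) = ⊢-weaken (s x)

TypedSub-liftPI : ∀ {Γ Δ σ} → TypedSub Γ Δ σ → TypedSub (map shiftF Γ) (map shiftF Δ) (liftPI σ)
TypedSub-liftPI s x with ∋-map⁻ shiftF x
... | A , y , refl = ⊢-substIP shiftσ (s y)

⊢-substP : ∀ {Γ Δ σ t A} → TypedSub Γ Δ σ → Γ ⊢ t ∶ A → Δ ⊢ substP σ t ∶ A
⊢-substP s (⊢var x) = s x
⊢-substP s (⊢pair d d₁) = ⊢pair (⊢-substP s d) (⊢-substP s d₁)
⊢-substP s (⊢π0 d) = ⊢π0 (⊢-substP s d)
⊢-substP s (⊢π1 d) = ⊢π1 (⊢-substP s d)
⊢-substP s (⊢app d d₁) = ⊢app (⊢-substP s d) (⊢-substP s d₁)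
⊢-substP s (⊢lam d) = ⊢lam (⊢-substP (TypedSub-liftP s) d)
⊢-substP s (⊢inj0 d) = ⊢inj0 (⊢-substP s d)
⊢-substP s (⊢inj1 d) = ⊢inj1 (⊢-substP s d)
⊢-substP s (⊢case d d₁ d₂) = ⊢case (⊢-substP s d) (⊢-substP (TypedSub-liftP s) d₁) (⊢-substP (TypedSub-liftP s) d₂)
⊢-substP s (⊢allE d) = ⊢allE (⊢-substP s d)
⊢-substP s (⊢allI d) = ⊢allI (⊢-substP (TypedSub-liftPI s) d)
⊢-substP s (⊢exI d) = ⊢exI (⊢-substP s d)
⊢-substP s (⊢exE d d₁) = ⊢exE (⊢-substP s d) (⊢-substP (TypedSub-liftP (TypedSub-liftPI s)) d₁)
⊢-substP s (⊢par d d₁) = ⊢par (⊢-substP (TypedSub-liftP s) d) (⊢-substP (TypedSub-liftP s) d₁)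
⊢-substP s (⊢efq x d) = ⊢efq x (⊢-substP s d)
⊢-substP s ⊢abort = ⊢abort

TypedSub-consP : ∀ {Γ t A} → Γ ⊢ t ∶ A → TypedSub (A ∷ Γ) Γ (consP t)
TypedSub-consP d here = d
TypedSub-consP d (there x) = ⊢var x

∧'-injective : ∀ {A B A' B'} → A ∧' B ≡ A' ∧' B' → A ≡ A' × B ≡ B'
∧'-injective refl = refl , refl
⇒-injective : ∀ {A B A' B'} → (A ⇒ B) ≡ (A' ⇒ B') → A ≡ A' × B ≡ B'
⇒-injective refl = refl , refl
∀'-injective : ∀ {A A'} → ∀' A ≡ ∀' A' → A ≡ A'
∀'-injective refl = refl

⊢-unique : ∀ {Γ t A B} → Γ ⊢ t ∶ A → Γ ⊢ t ∶ B → A ≡ B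
⊢-unique (⊢var x) (⊢var y) = ∋-unique x y
⊢-unique (⊢pair d d₁) (⊢pair e e₁) = cong₂ _∧'_ (⊢-unique d e) (⊢-unique d₁ e₁)
⊢-unique (⊢π0 d) (⊢π0 e) = proj₁ (∧'-injective (⊢-unique d e))
⊢-unique (⊢π1 d) (⊢π1 e) = proj₂ (∧'-injective (⊢-unique d e))
⊢-unique (⊢app d d₁) (⊢app e e₁) = proj₂ (⇒-injective (⊢-unique d e))
⊢-unique (⊢lam d) (⊢lam e) = cong (_ ⇒_) (⊢-unique d e)
⊢-unique (⊢inj0 d) (⊢inj0 e) = cong (_∨' _) (⊢-unique d e)
⊢-unique (⊢inj1 d) (⊢inj1 e) = cong (_ ∨'_) (⊢-unique d e)
⊢-unique (⊢case d d₁ d₂) (⊢case e e₁ e₂) = ⊢-unique d₁ e₁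
⊢-unique (⊢allE d) (⊢allE e) = cong (_[ _ ]F) (∀'-injective (⊢-unique d e))
⊢-unique (⊢allI d) (⊢allI e) = cong ∀' (⊢-unique d e)
⊢-unique (⊢exI d) (⊢exI e) = refl
⊢-unique (⊢exE d d₁) (⊢exE e e₁) = shiftF-injective (⊢-unique d₁ e₁)
⊢-unique (⊢par d d₁) (⊢par e e₁) = ⊢-unique d e
⊢-unique (⊢efq x d) (⊢efq y e) = refl
⊢-unique ⊢abort ⊢abort = refl

⊢-◂-head : ∀ {Γ t σ A} → Γ ⊢ t ◂ σ ∶ A → Σ Fm λ B → Γ ⊢ t ∶ B
⊢-◂-head {σ = []} d = _ , d
⊢-◂-head {σ = ξ ∷ σ} d with ⊢-◂-head {σ = σ} d
... | _ , ⊢π0 e = _ , e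
... | _ , ⊢π1 e = _ , e
... | _ , ⊢app e e₁ = _ , e
... | _ , ⊢case e e₁ e₂ = _ , e
... | _ , ⊢allE e = _ , e
... | _ , ⊢exE e e₁ = _ , e

⊢-·-replace-head : ∀ {Γ t t' ξ A B} → Γ ⊢ t · ξ ∶ A → Γ ⊢ t ∶ B → Γ ⊢ t' ∶ B → Γ ⊢ t' · ξ ∶ A
⊢-·-replace-head {Γ} {t' = t'} (⊢π0 e) d d' = ⊢π0 (subst (λ Z → Γ ⊢ t' ∶ Z) (⊢-unique d e) d')
⊢-·-replace-head {Γ} {t' = t'} (⊢π1 e) d d' = ⊢π1 (subst (λ Z → Γ ⊢ t' ∶ Z) (⊢-unique d e) d')
⊢-·-replace-head {Γ} {t' = t'} (⊢app e e₁) d d' = ⊢app (subst (λ Z → Γ ⊢ t' ∶ Z) (⊢-unique d e) d') e₁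
⊢-·-replace-head {Γ} {t' = t'} (⊢case e e₁ e₂) d d' = ⊢case (subst (λ Z → Γ ⊢ t' ∶ Z) (⊢-unique d e) d') e₁ e₂
⊢-·-replace-head {Γ} {t' = t'} (⊢allE e) d d' = ⊢allE (subst (λ Z → Γ ⊢ t' ∶ Z) (⊢-unique d e) d')
⊢-·-replace-head {Γ} {t' = t'} (⊢exE e e₁) d d' = ⊢exE (subst (λ Z → Γ ⊢ t' ∶ Z) (⊢-unique d e) d') e₁

⊢-◂-replace-head : ∀ {Γ t t' σ A B} → Γ ⊢ t ◂ σ ∶ A → Γ ⊢ t ∶ B → Γ ⊢ t' ∶ B → Γ ⊢ t' ◂ σ ∶ A
⊢-◂-replace-head {Γ} {t' = t'} {σ = []} d e e' = subst (λ Z → Γ ⊢ t' ∶ Z) (⊢-unique e d) e'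
⊢-◂-replace-head {t = t} {t'} {σ = ξ ∷ σ} d e e' with ⊢-◂-head {t = t · ξ} {σ = σ} d
... | B' , f = ⊢-◂-replace-head {t = t · ξ} {t' · ξ} {σ = σ} d f (⊢-·-replace-head f e e')

⊢-plug : ∀ {Γ C p A} → Γ ⊢ plug C p ∶ A → holeCtx C Γ ⊢ p ∶ A
⊢-plug {C = hole} d = d
⊢-plug {C = inL A B C v} (⊢par d d₁) = ⊢-plug {C = C} d
⊢-plug {C = inR A B u C} (⊢par d d₁) = ⊢-plug {C = C} d₁

-- Stacks and parallel processes

NotApp : PT → Set
NotApp (_ · _) = ⊥
NotApp _ = ⊤

spine : PT → PT × List Elim
spine (t · ξ) = proj₁ (spine t) , proj₂ (spine t) ++ (ξ ∷ [])
spine (pv i) = pv i , []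
spine (pair u t) = pair u t , []
spine (lam A u) = lam A u , []
spine (inj0 B u) = inj0 B u , []
spine (inj1 A u) = inj1 A u , []
spine (Lam u) = Lam u , []
spine (wit A m u) = wit A m u , []
spine (par A B u v) = par A B u v , []
spine (efq P u) = efq P u , []
spine (abort A B) = abort A B , []

spine-NotApp : ∀ h → NotApp h → spine h ≡ (h , [])
spine-NotApp (pv _) _ = refl
spine-NotApp (pair _ _) _ = refl
spine-NotApp (lam _ _) _ = refl
spine-NotApp (inj0 _ _) _ = refl
spine-NotApp (inj1 _ _) _ = refl
spine-NotApp (Lam _) _ = refl
spine-NotApp (wit _ _ _) _ = refl
spine-NotApp (par _ _ _ _) _ = refl
spine-NotApp (efq _ _) _ = refl
spine-NotApp (abort _ _) _ = refl

spine-◂ : ∀ t σ → spine (t ◂ σ) ≡ (proj₁ (spine t) , proj₂ (spine t) ++ σ)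
spine-◂ t [] = cong (proj₁ (spine t) ,_) (sym (++-identityʳ _))
spine-◂ t (ξ ∷ σ) = trans (spine-◂ (t · ξ) σ) (cong (proj₁ (spine t) ,_) (++-assoc (proj₂ (spine t)) (ξ ∷ []) σ))

◂-injective : ∀ {h h' σ σ'} → NotApp h → NotApp h' → h ◂ σ ≡ h' ◂ σ' → h ≡ h' × σ ≡ σ'
◂-injective {h} {h'} {σ} {σ'} n n' e with trans (sym (spine-◂ h σ)) (trans (cong spine e) (spine-◂ h' σ'))
... | q rewrite spine-NotApp h n | spine-NotApp h' n' with q
... | refl = refl , refl

◂-snoc : ∀ h σ ξ → h ◂ (σ ++ ξ ∷ []) ≡ (h ◂ σ) · ξ
◂-snoc h [] ξ = refl
◂-snoc h (x ∷ σ) ξ = ◂-snoc (h · x) σ ξ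

◂-decompose : ∀ t → Σ PT λ h → Σ (List Elim) λ σ → NotApp h × t ≡ h ◂ σ
◂-decompose (t · ξ) with ◂-decompose t
... | h , σ , n , e = h , σ ++ ξ ∷ [] , n , trans (cong (_· ξ) e) (sym (◂-snoc h σ ξ))
◂-decompose (pv _) = _ , [] , tt , refl
◂-decompose (pair _ _) = _ , [] , tt , refl
◂-decompose (lam _ _) = _ , [] , tt , refl
◂-decompose (inj0 _ _) = _ , [] , tt , refl
◂-decompose (inj1 _ _) = _ , [] , tt , refl
◂-decompose (Lam _) = _ , [] , tt , refl
◂-decompose (wit _ _ _) = _ , [] , tt , refl
◂-decompose (par _ _ _ _) = _ , [] , tt , refl
◂-decompose (efq _ _) = _ , [] , tt , refl
◂-decompose (abort _ _) = _ , [] , tt , refl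

substP-◂ : ∀ τ h σ → substP τ (h ◂ σ) ≡ substP τ h ◂ map (substE τ) σ
substP-◂ τ h [] = refl
substP-◂ τ h (ξ ∷ σ) = substP-◂ τ (h · ξ) σ

NotApp-substP : ∀ τ h → NotApp h → (∀ i → h ≢ pv i) → NotApp (substP τ h)
NotApp-substP τ (pv x) _ nv = ⊥-elim (nv x refl)
NotApp-substP τ (pair _ _) _ _ = tt
NotApp-substP τ (lam _ _) _ _ = tt
NotApp-substP τ (inj0 _ _) _ _ = tt
NotApp-substP τ (inj1 _ _) _ _ = tt
NotApp-substP τ (Lam _) _ _ = tt
NotApp-substP τ (wit _ _ _) _ _ = tt
NotApp-substP τ (par _ _ _ _) _ _ = tt
NotApp-substP τ (efq _ _) _ _ = tt
NotApp-substP τ (abort _ _) _ _ = tt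

Elementary : PT → Set
Elementary t = nproc t ≡ 1

par-or-Elementary : ∀ t → (Σ Fm λ A → Σ Fm λ B → Σ PT λ u → Σ PT λ v → t ≡ par A B u v) ⊎ Elementary t
par-or-Elementary (par A B u v) = inj₁ (A , B , u , v , refl)
par-or-Elementary (pv _) = inj₂ refl
par-or-Elementary (_ · _) = inj₂ refl
par-or-Elementary (pair _ _) = inj₂ refl
par-or-Elementary (lam _ _) = inj₂ refl
par-or-Elementary (inj0 _ _) = inj₂ refl
par-or-Elementary (inj1 _ _) = inj₂ refl
par-or-Elementary (Lam _) = inj₂ refl
par-or-Elementary (wit _ _ _) = inj₂ refl
par-or-Elementary (efq _ _) = inj₂ refl
par-or-Elementary (abort _ _) = inj₂ refl

nproc-positive : ∀ t → 1 ≤ nproc t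
nproc-positive t with par-or-Elementary t
... | inj₁ (A , B , u , v , refl) = ≤-trans (nproc-positive u) (m≤m+n (nproc u) (nproc v))
... | inj₂ e rewrite e = ≤-refl

par-not-Elementary : ∀ {A B u v} → Elementary (par A B u v) → ⊥
par-not-Elementary {u = u} {v} e with subst (2 ≤_) e (+-mono-≤ (nproc-positive u) (nproc-positive v))
... | s≤s ()

Elementary-◂ : ∀ h σ → Elementary h → Elementary (h ◂ σ)
Elementary-◂ h [] n = n
Elementary-◂ h (ξ ∷ σ) n = Elementary-◂ (h · ξ) σ refl

Elementary-plug⇒hole : ∀ {x C y} → Elementary x → x ≡ plug C y → C ≡ hole
Elementary-plug⇒hole {C = hole} n e = refl
Elementary-plug⇒hole {C = inL A B C v} n refl = ⊥-elim (par-not-Elementary {A} {B} {plug C _} {v} n)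
Elementary-plug⇒hole {C = inR A B u C} n refl = ⊥-elim (par-not-Elementary {A} {B} {u} {plug C _} n)

par-injective : ∀ {A B a b A' B' a' b'} → par A B a b ≡ par A' B' a' b' → A ≡ A' × B ≡ B' × a ≡ a' × b ≡ b'
par-injective refl = refl , refl , refl , refl

plug-injective : ∀ C {x y} → plug C x ≡ plug C y → x ≡ y
plug-injective hole e = e
plug-injective (inL A B C v) e = plug-injective C (proj₁ (proj₂ (proj₂ (par-injective e))))
plug-injective (inR A B u C) e = plug-injective C (proj₂ (proj₂ (proj₂ (par-injective e))))

nproc-plug-cong : ∀ C {x y} → nproc x ≡ nproc y → nproc (plug C x) ≡ nproc (plug C y)
nproc-plug-cong hole e = e
nproc-plug-cong (inL A B C v) e = cong (_+ nproc v) (nproc-plug-cong C e)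
nproc-plug-cong (inR A B u C) e = cong (nproc u +_) (nproc-plug-cong C e)

left<nproc-plug : ∀ C y → left C < nproc (plug C y)
left<nproc-plug hole y = nproc-positive y
left<nproc-plug (inL A B C v) y = ≤-trans (left<nproc-plug C y) (m≤m+n _ _)
left<nproc-plug (inR A B u C) y = +-monoʳ-< (nproc u) (left<nproc-plug C y)

liftPN : ℕ → (ℕ → PT) → ℕ → PT
liftPN zero σ = σ
liftPN (suc k) σ = liftPN k (liftP σ)

liftPN-suc : ∀ k σ → liftPN (suc k) σ ≗ liftP (liftPN k σ)
liftPN-suc zero σ i = refl
liftPN-suc (suc k) σ i = liftPN-suc k (liftP σ) i

liftPN-< : ∀ k σ i → i < k → liftPN k σ i ≡ pv i
liftPN-< (suc k) σ zero p = trans (liftPN-suc k σ zero) refl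
liftPN-< (suc k) σ (suc i) (s≤s p) = trans (liftPN-suc k σ (suc i)) (cong (renP suc) (liftPN-< k σ i p))

liftPN-+ : ∀ k σ i → liftPN k σ (k + i) ≡ renP (k +_) (σ i)
liftPN-+ zero σ i = sym (trans (renP≡substP (λ x → x) (σ i)) (substP-id (σ i)))
liftPN-+ (suc k) σ i = trans (liftPN-suc k σ (suc (k + i)))
  (trans (cong (renP suc) (liftPN-+ k σ i)) (renP-∘ suc (k +_) (σ i)))

substCtx : (ℕ → PT) → PCtx → PCtx
substCtx σ hole = hole
substCtx σ (inL A B C v) = inL A B (substCtx (liftP σ) C) (substP (liftP σ) v)
substCtx σ (inR A B u C) = inR A B (substP (liftP σ) u) (substCtx (liftP σ) C)

substP-plug : ∀ σ C p → substP σ (plug C p) ≡ plug (substCtx σ C) (substP (liftPN (depth C) σ) p)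
substP-plug σ hole p = refl
substP-plug σ (inL A B C v) p = cong (λ x → par A B x (substP (liftP σ) v)) (substP-plug (liftP σ) C p)
substP-plug σ (inR A B u C) p = cong (par A B (substP (liftP σ) u)) (substP-plug (liftP σ) C p)

depth-substCtx : ∀ σ C → depth (substCtx σ C) ≡ depth C
depth-substCtx σ hole = refl
depth-substCtx σ (inL A B C v) = cong suc (depth-substCtx (liftP σ) C)
depth-substCtx σ (inR A B u C) = cong suc (depth-substCtx (liftP σ) C)

holeCtx-substCtx : ∀ σ C Γ → holeCtx (substCtx σ C) Γ ≡ holeCtx C Γ
holeCtx-substCtx σ hole Γ = refl
holeCtx-substCtx σ (inL A B C v) Γ = holeCtx-substCtx (liftP σ) C _
holeCtx-substCtx σ (inR A B u C) Γ = holeCtx-substCtx (liftP σ) C _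

-- The shape of [𝒜/a] and of its liftings under binders.
VarsButλ : (ℕ → PT) → ℕ → Set
VarsButλ τ k = ∀ j → (Σ ℕ λ i → τ j ≡ pv i) ⊎ (j ≡ k × Σ Fm λ A → Σ PT λ Z → τ j ≡ lam A Z)

VarsButλ-liftP : ∀ {τ k} → VarsButλ τ k → VarsButλ (liftP τ) (suc k)
VarsButλ-liftP sh zero = inj₁ (0 , refl)
VarsButλ-liftP sh (suc j) with sh j
... | inj₁ (i , e) = inj₁ (suc i , cong (renP suc) e)
... | inj₂ (e , A , Z , e') = inj₂ (cong suc e , A , renP (liftR suc) Z , cong (renP suc) e')

VarsButλ-liftPN : ∀ d {τ k} → VarsButλ τ k → VarsButλ (liftPN d τ) (d + k)
VarsButλ-liftPN zero sh = sh
VarsButλ-liftPN (suc d) {τ} {k} sh = subst (VarsButλ (liftPN d (liftP τ))) (+-suc d k) (VarsButλ-liftPN d (VarsButλ-liftP sh))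

VarsButλ-≢par : ∀ {τ k} → VarsButλ τ k → ∀ j {A B Y Z} → τ j ≢ par A B Y Z
VarsButλ-≢par sh j e with sh j
... | inj₁ (i , e') with trans (sym e') e
... | ()
VarsButλ-≢par sh j e | inj₂ (_ , _ , _ , e') with trans (sym e') e
... | ()

VarsButλ-Elementary : ∀ {τ k} → VarsButλ τ k → ∀ j → Elementary (τ j)
VarsButλ-Elementary sh j with sh j
... | inj₁ (i , e) rewrite e = refl
... | inj₂ (_ , _ , _ , e) rewrite e = refl

nproc-substP : ∀ {τ k} → VarsButλ τ k → ∀ t → nproc (substP τ t) ≡ nproc t
nproc-substP sh (pv x) = VarsButλ-Elementary sh x
nproc-substP sh (_ · _) = refl
nproc-substP sh (pair _ _) = refl
nproc-substP sh (lam _ _) = refl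
nproc-substP sh (inj0 _ _) = refl
nproc-substP sh (inj1 _ _) = refl
nproc-substP sh (Lam _) = refl
nproc-substP sh (wit _ _ _) = refl
nproc-substP sh (par _ _ t t₁) = cong₂ _+_ (nproc-substP (VarsButλ-liftP sh) t) (nproc-substP (VarsButλ-liftP sh) t₁)
nproc-substP sh (efq _ _) = refl
nproc-substP sh (abort _ _) = refl

left-substCtx : ∀ {τ k} → VarsButλ τ k → ∀ C → left (substCtx τ C) ≡ left C
left-substCtx sh hole = refl
left-substCtx sh (inL A B C v) = left-substCtx (VarsButλ-liftP sh) C
left-substCtx sh (inR A B u C) = cong₂ _+_ (nproc-substP (VarsButλ-liftP sh) u) (left-substCtx (VarsButλ-liftP sh) C)

Contr-NotApp : ∀ {r ξ h} → Contr r ξ h → NotApp r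
Contr-NotApp βλ = tt
Contr-NotApp β∀ = tt
Contr-NotApp βπ0 = tt
Contr-NotApp βπ1 = tt
Contr-NotApp βι0 = tt
Contr-NotApp βι1 = tt
Contr-NotApp β∃ = tt
Contr-NotApp (∥ξ _) = tt

Contr-lam-argP : ∀ {A Z ξ h} → Contr (lam A Z) ξ h → Σ PT λ t → ξ ≡ argP t
Contr-lam-argP βλ = _ , refl

¬Contr-pv : ∀ {i ξ h} → Contr (pv i) ξ h → ⊥
¬Contr-pv ()

map-≡-∷ : ∀ τ σ0 {ξ σ} → ξ ∷ σ ≡ map (substE τ) σ0 → Σ Elim λ ξ0 → Σ (List Elim) λ σ0' → σ0 ≡ ξ0 ∷ σ0' × ξ ≡ substE τ ξ0 × σ ≡ map (substE τ) σ0'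
map-≡-∷ τ (ξ0 ∷ σ0) refl = ξ0 , σ0 , refl , refl , refl

Contr-reflect : ∀ τ h ξ {h'} → (∀ i → h ≢ pv i) → Contr (substP τ h) (substE τ ξ) h' → Σ PT (Contr h ξ)
Contr-reflect τ (pv i) ξ nv c = ⊥-elim (nv i refl)
Contr-reflect τ (_ · _) ξ nv ()
Contr-reflect τ (efq _ _) ξ nv ()
Contr-reflect τ (abort _ _) ξ nv ()
Contr-reflect τ (lam _ _) (argP _) nv βλ = _ , βλ
Contr-reflect τ (Lam _) (argT _) nv β∀ = _ , β∀
Contr-reflect τ (pair _ _) prj0 nv βπ0 = _ , βπ0
Contr-reflect τ (pair _ _) prj1 nv βπ1 = _ , βπ1
Contr-reflect τ (inj0 _ _) (case _ _ _ _) nv βι0 = _ , βι0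
Contr-reflect τ (inj1 _ _) (case _ _ _ _) nv βι1 = _ , βι1
Contr-reflect τ (wit _ _ _) (exE _ _) nv β∃ = _ , β∃
Contr-reflect τ (par _ _ _ _) (argP _) nv (∥ξ _) = _ , ∥ξ (pArgP _)
Contr-reflect τ (par _ _ _ _) prj0 nv (∥ξ _) = _ , ∥ξ pPrj0
Contr-reflect τ (par _ _ _ _) prj1 nv (∥ξ _) = _ , ∥ξ pPrj1
Contr-reflect τ (par _ _ _ _) (case _ _ _ _) nv (∥ξ _) = _ , ∥ξ (pCase _ _ _ _)
Contr-reflect τ (par _ _ _ _) (exE _ _) nv (∥ξ _) = _ , ∥ξ (pExE _ _)
Contr-reflect τ (par _ _ _ _) (argT _) nv (∥ξ ())
Contr-reflect τ (lam _ _) (argT _) nv ()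
Contr-reflect τ (lam _ _) prj0 nv ()
Contr-reflect τ (lam _ _) prj1 nv ()
Contr-reflect τ (lam _ _) (case _ _ _ _) nv ()
Contr-reflect τ (lam _ _) (exE _ _) nv ()
Contr-reflect τ (Lam _) (argP _) nv ()
Contr-reflect τ (Lam _) prj0 nv ()
Contr-reflect τ (Lam _) prj1 nv ()
Contr-reflect τ (Lam _) (case _ _ _ _) nv ()
Contr-reflect τ (Lam _) (exE _ _) nv ()
Contr-reflect τ (pair _ _) (argP _) nv ()
Contr-reflect τ (pair _ _) (argT _) nv ()
Contr-reflect τ (pair _ _) (case _ _ _ _) nv ()
Contr-reflect τ (pair _ _) (exE _ _) nv ()
Contr-reflect τ (inj0 _ _) (argP _) nv ()
Contr-reflect τ (inj0 _ _) (argT _) nv ()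
Contr-reflect τ (inj0 _ _) prj0 nv ()
Contr-reflect τ (inj0 _ _) prj1 nv ()
Contr-reflect τ (inj0 _ _) (exE _ _) nv ()
Contr-reflect τ (inj1 _ _) (argP _) nv ()
Contr-reflect τ (inj1 _ _) (argT _) nv ()
Contr-reflect τ (inj1 _ _) prj0 nv ()
Contr-reflect τ (inj1 _ _) prj1 nv ()
Contr-reflect τ (inj1 _ _) (exE _ _) nv ()
Contr-reflect τ (wit _ _ _) (argP _) nv ()
Contr-reflect τ (wit _ _ _) (argT _) nv ()
Contr-reflect τ (wit _ _ _) prj0 nv ()
Contr-reflect τ (wit _ _ _) prj1 nv ()
Contr-reflect τ (wit _ _ _) (case _ _ _ _) nv ()

pv? : ∀ h → (Σ ℕ λ j → h ≡ pv j) ⊎ (∀ i → h ≢ pv i)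
pv? (pv i0) = inj₁ (i0 , refl)
pv? (_ · _) = inj₂ (λ i ())
pv? (pair _ _) = inj₂ (λ i ())
pv? (lam _ _) = inj₂ (λ i ())
pv? (inj0 _ _) = inj₂ (λ i ())
pv? (inj1 _ _) = inj₂ (λ i ())
pv? (Lam _) = inj₂ (λ i ())
pv? (wit _ _ _) = inj₂ (λ i ())
pv? (par _ _ _ _) = inj₂ (λ i ())
pv? (efq _ _) = inj₂ (λ i ())
pv? (abort _ _) = inj₂ (λ i ())

substP-≡-abort : ∀ τ h0 {A B} → (∀ i → h0 ≢ pv i) → abort A B ≡ substP τ h0 → h0 ≡ abort A B
substP-≡-abort τ (pv i0) nv e = ⊥-elim (nv i0 refl)
substP-≡-abort τ (_ · _) _ ()
substP-≡-abort τ (pair _ _) _ ()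
substP-≡-abort τ (lam _ _) _ ()
substP-≡-abort τ (inj0 _ _) _ ()
substP-≡-abort τ (inj1 _ _) _ ()
substP-≡-abort τ (Lam _) _ ()
substP-≡-abort τ (wit _ _ _) _ ()
substP-≡-abort τ (par _ _ _ _) _ ()
substP-≡-abort τ (efq _ _) _ ()
substP-≡-abort τ (abort _ _) _ refl = refl

substP-≢pv : ∀ τ h0 {n} → (∀ i → h0 ≢ pv i) → substP τ h0 ≢ pv n
substP-≢pv τ (pv i0) nv e = nv i0 refl
substP-≢pv τ (_ · _) _ ()
substP-≢pv τ (pair _ _) _ ()
substP-≢pv τ (lam _ _) _ ()
substP-≢pv τ (inj0 _ _) _ ()
substP-≢pv τ (inj1 _ _) _ ()
substP-≢pv τ (Lam _) _ ()
substP-≢pv τ (wit _ _ _) _ ()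
substP-≢pv τ (par _ _ _ _) _ ()
substP-≢pv τ (efq _ _) _ ()
substP-≢pv τ (abort _ _) _ ()

substE-≡-argP : ∀ τ ξ0 {t} → substE τ ξ0 ≡ argP t → Σ PT λ t0 → ξ0 ≡ argP t0 × t ≡ substP τ t0
substE-≡-argP τ (argP t1) refl = t1 , refl , refl
substE-≡-argP τ (argT _) ()
substE-≡-argP τ prj0 ()
substE-≡-argP τ prj1 ()
substE-≡-argP τ (case _ _ _ _) ()
substE-≡-argP τ (exE _ _) ()

renP-≡-pv : ∀ ρ t {n} → renP ρ t ≡ pv n → Σ ℕ λ y → t ≡ pv y × ρ y ≡ n
renP-≡-pv ρ (pv i0) refl = i0 , refl , refl
renP-≡-pv ρ (_ · _) ()
renP-≡-pv ρ (pair _ _) ()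
renP-≡-pv ρ (lam _ _) ()
renP-≡-pv ρ (inj0 _ _) ()
renP-≡-pv ρ (inj1 _ _) ()
renP-≡-pv ρ (Lam _) ()
renP-≡-pv ρ (wit _ _ _) ()
renP-≡-pv ρ (par _ _ _ _) ()
renP-≡-pv ρ (efq _ _) ()
renP-≡-pv ρ (abort _ _) ()

substP-≡-par : ∀ {τ k} → VarsButλ τ k → ∀ X {A B Y Z} → substP τ X ≡ par A B Y Z → Σ PT λ X1 → Σ PT λ X2 → X ≡ par A B X1 X2 × Y ≡ substP (liftP τ) X1 × Z ≡ substP (liftP τ) X2
substP-≡-par sh (pv i0) e = ⊥-elim (VarsButλ-≢par sh i0 e)
substP-≡-par sh (_ · _) ()
substP-≡-par sh (pair _ _) ()
substP-≡-par sh (lam _ _) ()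
substP-≡-par sh (inj0 _ _) ()
substP-≡-par sh (inj1 _ _) ()
substP-≡-par sh (Lam _) ()
substP-≡-par sh (wit _ _ _) ()
substP-≡-par sh (par _ _ a0 b0) refl = a0 , b0 , refl , refl , refl
substP-≡-par sh (efq _ _) ()
substP-≡-par sh (abort _ _) ()

substP-≡-plug : ∀ {τ k} → VarsButλ τ k → ∀ C X {p} → substP τ X ≡ plug C p →
  Σ PCtx λ C0 → Σ PT λ p0 → X ≡ plug C0 p0 × C ≡ substCtx τ C0 × p ≡ substP (liftPN (depth C0) τ) p0
substP-≡-plug sh hole X e = hole , X , refl , refl , sym e
substP-≡-plug sh (inL A B C v) X e with substP-≡-par sh X e
... | X1 , X2 , refl , e1 , e2 with substP-≡-plug (VarsButλ-liftP sh) C X1 (sym e1)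
... | C0 , p0 , refl , refl , ep = inL A B C0 X2 , p0 , refl , cong (inL A B (substCtx (liftP _) C0)) e2 , ep
substP-≡-plug sh (inR A B u C) X e with substP-≡-par sh X e
... | X1 , X2 , refl , e1 , e2 with substP-≡-plug (VarsButλ-liftP sh) C X2 (sym e2)
... | C0 , p0 , refl , refl , ep = inR A B X1 C0 , p0 , refl , cong (λ z → inR A B z (substCtx (liftP _) C0)) e1 , ep

substP-sub1 : ∀ τ t u → substP τ (sub1 t u) ≡ sub1 (substP τ t) (substP (liftP τ) u)
substP-sub1 τ t u = trans (substP-∘ (consP t) τ u) (trans (substP-cong e u) (sym (substP-∘ (liftP τ) (consP (substP τ t)) u)))
  where
  e : ∀ i → substP τ (consP t i) ≡ substP (consP (substP τ t)) (liftP τ i)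
  e zero = refl
  e (suc i) = sym (trans (substP-renP (consP (substP τ t)) suc (τ i)) (substP-id (τ i)))

substP-isub1 : ∀ τ m u → substP τ (isub1 m u) ≡ isub1 m (substP (liftPI τ) u)
substP-isub1 τ m u = sym (trans (substIP-substP (consT m) (liftPI τ) u) (substP-cong e (isub1 m u)))
  where
  e : ∀ i → substIP (consT m) (shiftIP (τ i)) ≡ τ i
  e i = trans (substIP-∘ shiftσ (consT m) (τ i)) (trans (substIP-cong (λ _ → refl) (τ i)) (substIP-id (τ i)))

liftPI-liftP : ∀ τ → liftPI (liftP τ) ≗ liftP (liftPI τ)
liftPI-liftP τ zero = refl
liftPI-liftP τ (suc i) = sym (renP-substIP suc shiftσ (τ i))

substP-β∃ : ∀ τ u m v → substP τ (sub1 u (isub1 m v)) ≡ sub1 (substP τ u) (isub1 m (substP (liftP (liftPI τ)) v))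
substP-β∃ τ u m v = trans (substP-sub1 τ u (isub1 m v))
  (cong (sub1 (substP τ u)) (trans (substP-isub1 (liftP τ) m v) (cong (isub1 m) (substP-cong (liftPI-liftP τ) v))))

ParArg-substE : ∀ τ {ξ} → ParArg ξ → ParArg (substE τ ξ)
ParArg-substE τ (pArgP u) = pArgP _
ParArg-substE τ pPrj0 = pPrj0
ParArg-substE τ pPrj1 = pPrj1
ParArg-substE τ (pCase A B w₁ w₂) = pCase _ _ _ _
ParArg-substE τ (pExE A w) = pExE _ _

renE-suc-substE : ∀ τ ξ → renE suc (substE τ ξ) ≡ substE (liftP τ) (renE suc ξ)
renE-suc-substE τ ξ = trans (renE-substE suc τ ξ) (sym (substE-renE (liftP τ) suc ξ))

Contr-substP : ∀ τ {r ξ h} → Contr r ξ h → Contr (substP τ r) (substE τ ξ) (substP τ h)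
Contr-substP τ (βλ {A} {u} {t}) = subst (Contr _ _) (sym (substP-sub1 τ t u)) βλ
Contr-substP τ (β∀ {u} {m}) = subst (Contr _ _) (sym (substP-isub1 τ m u)) β∀
Contr-substP τ βπ0 = βπ0
Contr-substP τ βπ1 = βπ1
Contr-substP τ (βι0 {u = u} {w₀ = w₀}) = subst (Contr _ _) (sym (substP-sub1 τ u w₀)) βι0
Contr-substP τ (βι1 {u = u} {w₁ = w₁}) = subst (Contr _ _) (sym (substP-sub1 τ u w₁)) βι1
Contr-substP τ (β∃ {m = m} {u = u} {v = v}) = subst (Contr _ _) (sym (substP-β∃ τ u m v)) β∃
Contr-substP τ (∥ξ {A} {B} {u} {v} {ξ} pa) =
  subst (Contr _ _) (cong₂ (λ x y → par A B (substP (liftP τ) u · x) (substP (liftP τ) v · y)) (renE-suc-substE τ ξ) (renE-suc-substE τ ξ))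
    (∥ξ (ParArg-substE τ pa))

ProcStep-substP : ∀ {Γo Γs τ p q} → TypedSub Γo Γs τ → ProcStep Γo p q → ProcStep Γs (substP τ p) (substP τ q)
ProcStep-substP {τ = τ} sb (basic {r} {ξ} {h} {σ} c) =
  subst₂ (ProcStep _) (sym (substP-◂ τ (r · ξ) σ)) (sym (substP-◂ τ h σ)) (basic {σ = map (substE τ) σ} (Contr-substP τ c))
ProcStep-substP {τ = τ} sb (abortS {A} {B} {u} {σ} dt du) =
  subst (λ Y → ProcStep _ Y (substP τ u)) (sym (substP-◂ τ (abort A B · argP u) σ))
    (abortS {σ = map (substE τ) σ} (subst (λ Y → _ ⊢ Y ∶ _) (substP-◂ τ (abort A B · argP u) σ) (⊢-substP sb dt)) (⊢-substP sb du))

ProcStep-Elementary : ∀ {Γ p q} → ProcStep Γ p q → Elementary p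
ProcStep-Elementary (basic {r} {ξ} {σ = σ} c) = Elementary-◂ (r · ξ) σ refl
ProcStep-Elementary (abortS {A} {B} {u} {σ} dt du) = Elementary-◂ (abort A B · argP u) σ refl

varApp : ℕ → PT → List Elim → PT
varApp n s ρ = (pv n · argP s) ◂ ρ

pv-◂-stuck : ∀ {Γ p q i σ} → p ≡ pv i ◂ σ → ¬ ProcStep Γ p q
pv-◂-stuck {σ = σ} e (basic {r} {ξ} {σ = σ'} c) with ◂-injective {r} {pv _} {ξ ∷ σ'} {σ} (Contr-NotApp c) tt e
... | refl , _ = ¬Contr-pv c
pv-◂-stuck {σ = σ} e (abortS {A} {B} {u} {σ'} _ _) with ◂-injective {abort A B} {pv _} {argP u ∷ σ'} {σ} tt tt e
... | () , _

lam-◂-step : ∀ {Γ p q A Z σ} → p ≡ lam A Z ◂ σ → ProcStep Γ p q → Σ PT λ s → Σ (List Elim) λ ρ → σ ≡ argP s ∷ ρ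
lam-◂-step {σ = σ} e (basic {r} {ξ} {σ = σ'} c) with ◂-injective {r} {lam _ _} {ξ ∷ σ'} {σ} (Contr-NotApp c) tt e
... | refl , refl with Contr-lam-argP c
...   | s , refl = s , σ' , refl
lam-◂-step {σ = σ} e (abortS {A} {B} {u} {σ'} _ _) with ◂-injective {abort A B} {lam _ _} {argP u ∷ σ'} {σ} tt tt e
... | () , _

ProcStep-reflect-pv : ∀ {τ k Γ j σ p q} → VarsButλ τ k → p ≡ τ j ◂ map (substE τ) σ → ProcStep Γ p q →
  Σ PT λ s → Σ (List Elim) λ ρ → pv j ◂ σ ≡ varApp k s ρ
ProcStep-reflect-pv {τ} {j = j} {σ} sh e st with sh j
... | inj₁ (i , eτ) = ⊥-elim (pv-◂-stuck {σ = map (substE τ) σ} (trans e (cong (_◂ map (substE τ) σ) eτ)) st)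
... | inj₂ (refl , A , Z , eτ) with lam-◂-step {σ = map (substE τ) σ} (trans e (cong (_◂ map (substE τ) σ) eτ)) st
...   | s , ρ , eσ with map-≡-∷ τ σ (sym eσ)
...     | ξ , ρ₀ , refl , eξ , _ with substE-≡-argP τ ξ (sym eξ)
...       | s₀ , refl , _ = s₀ , ρ₀ , refl

ProcStep-reflect-head : ∀ {τ Γo Γs h σ T p q} → TypedSub Γo Γs τ → NotApp h → (∀ i → h ≢ pv i) →
  Γo ⊢ h ◂ σ ∶ T → p ≡ substP τ h ◂ map (substE τ) σ → ProcStep Γs p q → Σ PT (ProcStep Γo (h ◂ σ))
ProcStep-reflect-head {τ} {h = h} {σ} sb na nv dX e (basic {r} {ξ} {σ = σ'} c)
  with ◂-injective {r} {substP τ h} {ξ ∷ σ'} {map (substE τ) σ} (Contr-NotApp c) (NotApp-substP τ h na nv) e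
... | refl , es with map-≡-∷ τ σ es
...   | ξ₀ , σ₀ , refl , refl , refl with Contr-reflect τ h ξ₀ nv c
...     | h' , c₀ = h' ◂ σ₀ , basic {σ = σ₀} c₀
ProcStep-reflect-head {τ} {Γo} {Γs} {h} {σ} {T} sb na nv dX e (abortS {A} {B} {u} {σ'} dt du)
  with ◂-injective {abort A B} {substP τ h} {argP u ∷ σ'} {map (substE τ) σ} tt (NotApp-substP τ h na nv) e
... | ea , es with substP-≡-abort τ h nv ea | map-≡-∷ τ σ es
...   | refl | ξ₀ , σ₀ , refl , eξ , refl with substE-≡-argP τ ξ₀ (sym eξ)
...     | u₀ , refl , refl with ⊢-◂-head {t = abort A B · argP u₀} {σ = σ₀} dX
...       | _ , ⊢app ⊢abort du₀ = u₀ , abortS {σ = σ₀} dX (subst (λ Z → Γo ⊢ u₀ ∶ Z) (trans eA (sym eT)) du₀)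
  where
  eT = ⊢-unique (subst (λ Y → Γs ⊢ Y ∶ T) (substP-◂ τ (abort A B · argP u₀) σ₀) (⊢-substP sb dX)) dt
  eA = ⊢-unique (⊢-substP sb du₀) du

ProcStep-reflect : ∀ {τ k Γo Γs X T q} → VarsButλ τ k → TypedSub Γo Γs τ → Γo ⊢ X ∶ T → ProcStep Γs (substP τ X) q →
  Σ PT (ProcStep Γo X) ⊎ (Σ PT λ s → Σ (List Elim) λ ρ → X ≡ varApp k s ρ)
ProcStep-reflect {τ} {X = X} sh sb dX st with ◂-decompose X
... | h , σ , na , refl with pv? h
...   | inj₁ (j , refl) = inj₂ (ProcStep-reflect-pv {σ = σ} sh (substP-◂ τ (pv j) σ) st)
...   | inj₂ nv = inj₁ (ProcStep-reflect-head {σ = σ} sb na nv dX (substP-◂ τ h σ) st)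

liftPN-liftP-≡-pv : ∀ d τ j → liftPN d (liftP τ) j ≡ pv d → j ≡ d
liftPN-liftP-≡-pv zero τ zero e = refl
liftPN-liftP-≡-pv zero τ (suc j) e with renP-≡-pv suc (τ j) e
... | y , _ , ()
liftPN-liftP-≡-pv (suc d) τ j e with trans (sym (liftPN-suc d (liftP τ) j)) e
liftPN-liftP-≡-pv (suc d) τ zero e | ()
liftPN-liftP-≡-pv (suc d) τ (suc j) e | e' with renP-≡-pv suc (liftPN d (liftP τ) j) e'
... | y , e2 , refl = cong suc (liftPN-liftP-≡-pv d τ j e2)

VarsButλ-NotApp : ∀ {τ k} → VarsButλ τ k → ∀ j → NotApp (τ j)
VarsButλ-NotApp sh j with sh j
... | inj₁ (i , e) rewrite e = tt
... | inj₂ (_ , A , Z , e) rewrite e = tt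

AHeaded-substP : ∀ τ X D s ρ → AHeaded X D s ρ →
  AHeaded (substP (liftP τ) X) (substCtx (liftP τ) D) (substP (liftPN (depth D) (liftP τ)) s) (map (substE (liftPN (depth D) (liftP τ))) ρ)
AHeaded-substP τ X D s ρ refl =
  trans (substP-plug (liftP τ) D (varApp (depth D) s ρ))
   (cong (plug (substCtx (liftP τ) D))
     (trans (substP-◂ (liftPN (depth D) (liftP τ)) (pv (depth D) · argP s) ρ)
       (cong (λ z → (z · argP (substP (liftPN (depth D) (liftP τ)) s)) ◂ map (substE (liftPN (depth D) (liftP τ))) ρ)
          (trans (liftPN-< (suc (depth D)) τ (depth D) ≤-refl) (cong pv (sym (depth-substCtx (liftP τ) D)))))))

AHeadedAt : PT → PCtx → Set
AHeadedAt X D = Σ PCtx λ D0 → Σ PT λ s0 → Σ (List Elim) λ ρ0 → AHeaded X D0 s0 ρ0 × left D0 ≡ left D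

AHeaded-reflect : ∀ {τ k} → VarsButλ τ k → ∀ X D s ρ → AHeaded (substP (liftP τ) X) D s ρ → AHeadedAt X D
AHeaded-reflect {τ} {k} sh X D s ρ e with substP-≡-plug (VarsButλ-liftP sh) D X e
... | C0 , p0 , refl , refl , ep with ◂-decompose p0
... | h0 , σ0 , na , refl with pv? h0
... | inj₂ nv with ◂-injective {pv (depth D)} {substP (liftPN (depth C0) (liftP τ)) h0} {argP s ∷ ρ} {map (substE (liftPN (depth C0) (liftP τ))) σ0}
                     tt (NotApp-substP _ h0 na nv) (trans ep (substP-◂ _ h0 σ0))
...   | e1 , _ = ⊥-elim (substP-≢pv _ h0 nv (sym e1))
AHeaded-reflect {τ} {k} sh X D s ρ e | C0 , p0 , refl , refl , ep | h0 , σ0 , na , refl | inj₁ (j , refl)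
  with ◂-injective {pv (depth D)} {liftPN (depth C0) (liftP τ) j} {argP s ∷ ρ} {map (substE (liftPN (depth C0) (liftP τ))) σ0}
         tt (VarsButλ-NotApp (VarsButλ-liftPN (depth C0) (VarsButλ-liftP sh)) j) (trans ep (substP-◂ _ (pv j) σ0))
... | e1 , es with map-≡-∷ _ σ0 {argP s} {ρ} es
... | ξ0 , σ0' , refl , eξ , _ with substE-≡-argP _ ξ0 (sym eξ)
... | s0 , refl , _ with liftPN-liftP-≡-pv (depth C0) τ j (trans (sym e1) (cong pv (depth-substCtx (liftP τ) C0)))
... | refl = C0 , s0 , σ0' , refl , sym (left-substCtx (VarsButλ-liftP sh) C0)

Leftmost-reflect : ∀ {τ k} → VarsButλ τ k → ∀ X D s ρ → Leftmost (substP (liftP τ) X) D s ρ →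
  Σ PCtx λ D₀ → Σ PT λ s₀ → Σ (List Elim) λ ρ₀ → Leftmost X D₀ s₀ ρ₀ × left D₀ ≡ left D
Leftmost-reflect {τ} sh X D s ρ (ah , mn) with AHeaded-reflect sh X D s ρ ah
... | D₀ , s₀ , ρ₀ , ah₀ , eq = D₀ , s₀ , ρ₀ , (ah₀ , minimal) , eq
  where
  minimal : ∀ D' s' ρ' → AHeaded X D' s' ρ' → left D₀ ≤ left D'
  minimal D' s' ρ' a' =
    subst₂ _≤_ (sym eq) (left-substCtx (VarsButλ-liftP sh) D')
      (mn (substCtx (liftP τ) D') _ (map (substE (liftPN (depth D') (liftP τ))) ρ') (AHeaded-substP τ X D' s' ρ' a'))

Leftmost-substP : ∀ {τ k} → VarsButλ τ k → ∀ X D s ρ → Leftmost X D s ρ →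
  Leftmost (substP (liftP τ) X) (substCtx (liftP τ) D) (substP (liftPN (depth D) (liftP τ)) s) (map (substE (liftPN (depth D) (liftP τ))) ρ)
Leftmost-substP {τ} sh X D s ρ (ah , mn) = AHeaded-substP τ X D s ρ ah , minimal
  where
  minimal : ∀ D' s' ρ' → AHeaded (substP (liftP τ) X) D' s' ρ' → left (substCtx (liftP τ) D) ≤ left D'
  minimal D' s' ρ' a' with AHeaded-reflect sh X D' s' ρ' a'
  ... | D₀ , s₀ , ρ₀ , a₀ , eq = subst₂ _≤_ (sym (left-substCtx (VarsButλ-liftP sh) D)) eq (mn D₀ s₀ ρ₀ a₀)

NotAHeaded : PT → Set
NotAHeaded X = ∀ D s ρ → ¬ AHeaded X D s ρ

NotAHeaded-substP : ∀ {τ k} → VarsButλ τ k → ∀ X → NotAHeaded X → NotAHeaded (substP (liftP τ) X)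
NotAHeaded-substP sh X nh D s ρ a with AHeaded-reflect sh X D s ρ a
... | D₀ , s₀ , ρ₀ , a₀ , _ = nh D₀ s₀ ρ₀ a₀

NotAHeaded-reflect : ∀ τ X → NotAHeaded (substP (liftP τ) X) → NotAHeaded X
NotAHeaded-reflect τ X nh D s ρ a = nh (substCtx (liftP τ) D) _ (map (substE (liftPN (depth D) (liftP τ))) ρ) (AHeaded-substP τ X D s ρ a)

-- Head redexes of a parallel composition

+-assoc₄ : ∀ a b c d → a + b + c + d ≡ a + (b + c + d)
+-assoc₄ a b c d = trans (cong (_+ d) (+-assoc a b c)) (+-assoc a (b + c) d)

HasRedex : List Fm → PT → ℕ → Set
HasRedex Γ t m = Σ PT (Redex Γ t m)

ParRedex : List Fm → Fm → Fm → PT → PT → ℕ → Set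
ParRedex Γ A B X Y m =
  HasRedex ((A ⇒ B) ∷ Γ) X m
  ⊎ (Σ ℕ λ m' → m ≡ nproc X + m' × HasRedex ((B ⇒ A) ∷ Γ) Y m')
  ⊎ (Σ PCtx λ D → Σ PT λ s → Σ (List Elim) λ ρ → Leftmost X D s ρ × m ≡ left D)
  ⊎ (NotAHeaded X × Σ PCtx λ D → Σ PT λ s → Σ (List Elim) λ ρ → Leftmost Y D s ρ × m ≡ nproc X + left D)

par-redex-view : ∀ {Γ A B X Y m t'} → Redex Γ (par A B X Y) m t' → ParRedex Γ A B X Y m
par-redex-view {A = A} {B} {X} {Y} (internal hole p p' e st) = ⊥-elim (par-not-Elementary {A} {B} {X} {Y} (subst Elementary (sym e) (ProcStep-Elementary st)))
par-redex-view (internal (inL A B C v) p p' refl st) = inj₁ (_ , internal C p p' refl st)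
par-redex-view (internal (inR A B u C) p p' refl st) = inj₂ (inj₁ (left C , refl , _ , internal C p p' refl st))
par-redex-view (crossL hole A B u v D s ρ refl lm) = inj₂ (inj₂ (inj₁ (D , s , ρ , lm , refl)))
par-redex-view (crossL (inL A₁ B₁ C v₁) A B u v D s ρ refl lm) = inj₁ (_ , crossL C A B u v D s ρ refl lm)
par-redex-view (crossL (inR A₁ B₁ u₁ C) A B u v D s ρ refl lm) =
  inj₂ (inj₁ (left C + left D , +-assoc (nproc u₁) (left C) (left D) , _ , crossL C A B u v D s ρ refl lm))
par-redex-view (crossR hole A B u v D s ρ refl nh lm) = inj₂ (inj₂ (inj₂ (nh , D , s , ρ , lm , refl)))
par-redex-view (crossR (inL A₁ B₁ C v₁) A B u v D s ρ refl nh lm) = inj₁ (_ , crossR C A B u v D s ρ refl nh lm)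
par-redex-view (crossR (inR A₁ B₁ u₁ C) A B u v D s ρ refl nh lm) =
  inj₂ (inj₁ (left C + nproc u + left D , +-assoc₄ (nproc u₁) (left C) (nproc u) (left D) , _ , crossR C A B u v D s ρ refl nh lm))

HasRedex-inL : ∀ {Γ A B X Y m} → HasRedex ((A ⇒ B) ∷ Γ) X m → HasRedex Γ (par A B X Y) m
HasRedex-inL {A = A} {B} {Y = Y} (_ , internal C p p' refl st) = _ , internal (inL A B C Y) p p' refl st
HasRedex-inL {A = A} {B} {Y = Y} (_ , crossL C A' B' u v D s ρ refl lm) = _ , crossL (inL A B C Y) A' B' u v D s ρ refl lm
HasRedex-inL {A = A} {B} {Y = Y} (_ , crossR C A' B' u v D s ρ refl nh lm) = _ , crossR (inL A B C Y) A' B' u v D s ρ refl nh lm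

HasRedex-inR : ∀ {Γ A B X Y m} → HasRedex ((B ⇒ A) ∷ Γ) Y m → HasRedex Γ (par A B X Y) (nproc X + m)
HasRedex-inR {A = A} {B} {X = X} (_ , internal C p p' refl st) = _ , internal (inR A B X C) p p' refl st
HasRedex-inR {A = A} {B} {X = X} (_ , crossL C A' B' u v D s ρ refl lm) =
  subst (HasRedex _ _) (+-assoc (nproc X) (left C) (left D)) (_ , crossL (inR A B X C) A' B' u v D s ρ refl lm)
HasRedex-inR {A = A} {B} {X = X} (_ , crossR C A' B' u v D s ρ refl nh lm) =
  subst (HasRedex _ _) (+-assoc₄ (nproc X) (left C) (nproc u) (left D)) (_ , crossR (inR A B X C) A' B' u v D s ρ refl nh lm)

HasRedex-crossL : ∀ {Γ A B X Y} D s ρ → Leftmost X D s ρ → HasRedex Γ (par A B X Y) (left D)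
HasRedex-crossL {A = A} {B} {X} {Y} D s ρ lm = _ , crossL hole A B X Y D s ρ refl lm

HasRedex-crossR : ∀ {Γ A B X Y} D s ρ → NotAHeaded X → Leftmost Y D s ρ → HasRedex Γ (par A B X Y) (nproc X + left D)
HasRedex-crossR {A = A} {B} {X} {Y} D s ρ nh lm = _ , crossR hole A B X Y D s ρ refl nh lm

Redex-Elementary : ∀ {Γ t m t'} → Elementary t → Redex Γ t m t' → m ≡ 0 × ProcStep Γ t t'
Redex-Elementary n (internal hole p p' refl st) = refl , st
Redex-Elementary n (internal (inL A B C v) p p' refl st) = ⊥-elim (par-not-Elementary {A} {B} {plug C p} {v} n)
Redex-Elementary n (internal (inR A B u C) p p' refl st) = ⊥-elim (par-not-Elementary {A} {B} {u} {plug C p} n)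
Redex-Elementary n (crossL C A B u v D s ρ e lm) with Elementary-plug⇒hole {C = C} n e
... | refl = ⊥-elim (par-not-Elementary {A} {B} {u} {v} (subst Elementary e n))
Redex-Elementary n (crossR C A B u v D s ρ e nh lm) with Elementary-plug⇒hole {C = C} n e
... | refl = ⊥-elim (par-not-Elementary {A} {B} {u} {v} (subst Elementary e n))

AHeadedBelow : ℕ → PT → PCtx → PT → List Elim → Set
AHeadedBelow k X D s ρ = X ≡ plug D (varApp (depth D + k) s ρ)

AHeaded→AHeadedBelow : ∀ X D s ρ → AHeaded X D s ρ → AHeadedBelow 0 X D s ρ
AHeaded→AHeadedBelow X D s ρ e = trans e (cong (λ n → plug D (varApp n s ρ)) (sym (+-identityʳ (depth D))))

AHeadedBelow→AHeaded : ∀ X D s ρ → AHeadedBelow 0 X D s ρ → AHeaded X D s ρ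
AHeadedBelow→AHeaded X D s ρ e = trans e (cong (λ n → plug D (varApp n s ρ)) (+-identityʳ (depth D)))

Elementary-varApp : ∀ n s ρ → Elementary (varApp n s ρ)
Elementary-varApp n s ρ = Elementary-◂ (pv n · argP s) ρ refl

ReflectedRedex : List Fm → ℕ → PT → ℕ → Set
ReflectedRedex Γo k X m = HasRedex Γo X m ⊎ (Σ PCtx λ D → Σ PT λ s → Σ (List Elim) λ ρ → AHeadedBelow k X D s ρ × left D ≤ m)

Redex-reflect-Elementary : ∀ {Γo Γs τ k X T m t''} → VarsButλ τ k → TypedSub Γo Γs τ → Γo ⊢ X ∶ T → Elementary X → Redex Γs (substP τ X) m t'' → ReflectedRedex Γo k X m
Redex-reflect-Elementary {τ = τ} {X = X} sh sb d n r with Redex-Elementary (trans (nproc-substP sh X) n) r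
... | refl , st with ProcStep-reflect sh sb d st
... | inj₁ (q0 , st0) = inj₁ (q0 , internal hole X q0 refl st0)
... | inj₂ (s , ρ , e) = inj₂ (hole , s , ρ , e , z≤n)

mutual
  Redex-reflect : ∀ {Γo Γs τ k X T m t''} → VarsButλ τ k → TypedSub Γo Γs τ → Γo ⊢ X ∶ T →
    Redex Γs (substP τ X) m t'' → ReflectedRedex Γo k X m
  Redex-reflect {X = X} sh sb d r with par-or-Elementary X
  ... | inj₂ n = Redex-reflect-Elementary sh sb d n r
  Redex-reflect sh sb (⊢par d₁ d₂) r | inj₁ (_ , _ , _ , _ , refl) = Redex-reflect-par sh sb d₁ d₂ (par-redex-view r)

  Redex-reflect-par : ∀ {Γo Γs τ k A B X₁ X₂ T m} → VarsButλ τ k → TypedSub Γo Γs τ →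
    ((A ⇒ B) ∷ Γo) ⊢ X₁ ∶ T → ((B ⇒ A) ∷ Γo) ⊢ X₂ ∶ T →
    ParRedex Γs A B (substP (liftP τ) X₁) (substP (liftP τ) X₂) m → ReflectedRedex Γo k (par A B X₁ X₂) m
  Redex-reflect-par {k = k} {A} {B} {X₂ = X₂} sh sb d₁ d₂ (inj₁ (_ , r₁))
    with Redex-reflect (VarsButλ-liftP sh) (TypedSub-liftP sb) d₁ r₁
  ... | inj₁ r = inj₁ (HasRedex-inL r)
  ... | inj₂ (D , s , ρ , e , le) =
        inj₂ (inL A B D X₂ , s , ρ , cong (λ x → par A B x X₂) (trans e (cong (λ n → plug D (varApp n s ρ)) (+-suc (depth D) k))) , le)
  Redex-reflect-par {k = k} {A} {B} {X₁} sh sb d₁ d₂ (inj₂ (inj₁ (m' , refl , _ , r₂)))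
    with Redex-reflect (VarsButλ-liftP sh) (TypedSub-liftP sb) d₂ r₂
  ... | inj₁ r = inj₁ (subst (HasRedex _ _) (cong (_+ m') (sym (nproc-substP (VarsButλ-liftP sh) X₁))) (HasRedex-inR r))
  ... | inj₂ (D , s , ρ , e , le) =
        inj₂ (inR A B X₁ D , s , ρ , cong (par A B X₁) (trans e (cong (λ n → plug D (varApp n s ρ)) (+-suc (depth D) k))) ,
              subst (λ z → nproc X₁ + left D ≤ z + m') (sym (nproc-substP (VarsButλ-liftP sh) X₁)) (+-monoʳ-≤ (nproc X₁) le))
  Redex-reflect-par {X₁ = X₁} sh sb d₁ d₂ (inj₂ (inj₂ (inj₁ (D , s , ρ , lm , refl)))) with Leftmost-reflect sh X₁ D s ρ lm
  ... | D₀ , s₀ , ρ₀ , lm₀ , eq = inj₁ (subst (HasRedex _ _) eq (HasRedex-crossL D₀ s₀ ρ₀ lm₀))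
  Redex-reflect-par {τ = τ} {X₁ = X₁} {X₂} sh sb d₁ d₂ (inj₂ (inj₂ (inj₂ (nh , D , s , ρ , lm , refl)))) with Leftmost-reflect sh X₂ D s ρ lm
  ... | D₀ , s₀ , ρ₀ , lm₀ , eq =
        inj₁ (subst (HasRedex _ _) (cong₂ _+_ (sym (nproc-substP (VarsButλ-liftP sh) X₁)) eq)
                (HasRedex-crossR D₀ s₀ ρ₀ (NotAHeaded-reflect τ X₁ nh) lm₀))

plug-swap : ∀ E C1 {x y y'} → Elementary x → Elementary y → Elementary y' → plug E x ≡ plug C1 y → left E ≢ left C1 →
  Σ PCtx λ E' → plug E' x ≡ plug C1 y' × left E' ≡ left E × depth E' ≡ depth E
plug-swap hole C1 nx ny ny' e ne with Elementary-plug⇒hole {C = C1} nx e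
... | refl = ⊥-elim (ne refl)
plug-swap (inL A B E1 w) hole {x} nx ny ny' e ne = ⊥-elim (par-not-Elementary {A} {B} {plug E1 x} {w} (subst Elementary (sym e) ny))
plug-swap (inL A B E1 w) (inL A' B' C1 w') nx ny ny' e ne with par-injective e
... | refl , refl , e1 , refl with plug-swap E1 C1 nx ny ny' e1 ne
... | E' , e' , l , d = inL A B E' w , cong (λ z → par A B z w) e' , l , cong suc d
plug-swap (inL A B E1 w) (inR A' B' u C1) {y' = y'} nx ny ny' e ne with par-injective e
... | refl , refl , refl , refl = inL A B E1 (plug C1 y') , refl , refl , refl
plug-swap (inR A B w E1) hole {x} nx ny ny' e ne = ⊥-elim (par-not-Elementary {A} {B} {w} {plug E1 x} (subst Elementary (sym e) ny))
plug-swap (inR A B w E1) (inL A' B' C1 w') {y = y} {y'} nx ny ny' e ne with par-injective e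
... | refl , refl , refl , refl = inR A B (plug C1 y') E1 , refl , cong (_+ left E1) (nproc-plug-cong C1 {y'} {y} (trans ny' (sym ny))) , refl
plug-swap (inR A B w E1) (inR A' B' u C1) nx ny ny' e ne with par-injective e
... | refl , refl , refl , e2 with plug-swap E1 C1 nx ny ny' e2 (λ q → ne (cong (nproc w +_) q))
... | E' , e' , l , d = inR A B w E' , cong (par A B w) e' , cong (nproc w +_) l , cong suc d

Leftmost-swap : ∀ C1 {q0 q1} D s ρ → Elementary q0 → Elementary q1 → Leftmost (plug C1 q1) D s ρ → left D < left C1 →
  Σ PCtx λ D' → Leftmost (plug C1 q0) D' s ρ × left D' ≡ left D
Leftmost-swap C1 {q0} {q1} D s ρ n0 n1 (ah , mn) lt
  with plug-swap D C1 {varApp (depth D) s ρ} {q1} {q0} (Elementary-varApp _ s ρ) n1 n0 (sym ah) (λ e → <-irrefl e lt)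
... | E' , e' , l , d = E' , (ahE , mnE) , l
  where
  ahE : plug C1 q0 ≡ plug E' (varApp (depth E') s ρ)
  ahE = trans (sym e') (cong (λ n → plug E' (varApp n s ρ)) (sym d))
  mnE : ∀ D'' s'' ρ'' → AHeaded (plug C1 q0) D'' s'' ρ'' → left E' ≤ left D''
  mnE D'' s'' ρ'' a with left D'' ≟ left C1
  ... | yes eq = subst (_≤ left D'') (sym l) (<⇒≤ (subst (left D <_) (sym eq) lt))
  ... | no ne with plug-swap D'' C1 {varApp (depth D'') s'' ρ''} {q0} {q1} (Elementary-varApp _ s'' ρ'') n0 n1 (sym a) ne
  ...   | E'' , e'' , l'' , d'' =
          subst₂ _≤_ (sym l) l'' (mn E'' s'' ρ'' (trans (sym e'') (cong (λ n → plug E'' (varApp n s'' ρ'')) (sym d''))))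

m+n<o⇒o≮m : ∀ m n o → m + n < o → o ≮ m
m+n<o⇒o≮m m n o p q = n≮n m (<-trans (≤-<-trans (m≤m+n m n) p) q)

HasRedex-refill : ∀ {Γ} C {q0 q1 m} → Elementary q0 → Elementary q1 → HasRedex Γ (plug C q1) m → m < left C → HasRedex Γ (plug C q0) m
HasRedex-refill hole n0 n1 r ()
HasRedex-refill (inL A B C1 v) {q0} {q1} n0 n1 (_ , r) lt with par-redex-view r
... | inj₁ r1 = HasRedex-inL (HasRedex-refill C1 n0 n1 r1 lt)
... | inj₂ (inj₁ (m' , refl , _)) = contradiction (left<nproc-plug C1 q1) (m+n<o⇒o≮m (nproc (plug C1 q1)) m' (left C1) lt)
... | inj₂ (inj₂ (inj₁ (D , s , ρ , lm , refl))) with Leftmost-swap C1 D s ρ n0 n1 lm lt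
...   | D' , lm' , l = subst (HasRedex _ _) l (HasRedex-crossL D' s ρ lm')
HasRedex-refill (inL A B C1 v) {q0} {q1} n0 n1 (_ , r) lt | inj₂ (inj₂ (inj₂ (nh , D , s , ρ , lm , refl))) =
  contradiction (left<nproc-plug C1 q1) (m+n<o⇒o≮m (nproc (plug C1 q1)) (left D) (left C1) lt)
HasRedex-refill (inR A B u C1) {q0} {q1} n0 n1 (_ , r) lt with par-redex-view r
... | inj₁ r1 = HasRedex-inL r1
... | inj₂ (inj₁ (m' , refl , r2)) = HasRedex-inR (HasRedex-refill C1 n0 n1 r2 (+-cancelˡ-< (nproc u) m' (left C1) lt))
... | inj₂ (inj₂ (inj₁ (D , s , ρ , lm , refl))) = HasRedex-crossL D s ρ lm
... | inj₂ (inj₂ (inj₂ (nh , D , s , ρ , lm , refl))) with Leftmost-swap C1 D s ρ n0 n1 lm (+-cancelˡ-< (nproc u) (left D) (left C1) lt)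
...   | D' , lm' , l = subst (HasRedex _ _) (cong (nproc u +_) l) (HasRedex-crossR D' s ρ nh lm')

LeftmostBelow? : ℕ → PT → Set
LeftmostBelow? k X = (Σ PCtx λ D → Σ PT λ s → Σ (List Elim) λ ρ → AHeadedBelow k X D s ρ × (∀ D' s' ρ' → AHeadedBelow k X D' s' ρ' → left D ≤ left D'))
        ⊎ (∀ D s ρ → ¬ AHeadedBelow k X D s ρ)

AHeadedBelow-par : ∀ {k A B X1 X2} D s ρ → AHeadedBelow k (par A B X1 X2) D s ρ →
  (Σ PCtx λ D1 → D ≡ inL A B D1 X2 × AHeadedBelow (suc k) X1 D1 s ρ) ⊎ (Σ PCtx λ D2 → D ≡ inR A B X1 D2 × AHeadedBelow (suc k) X2 D2 s ρ)
AHeadedBelow-par {k} {A} {B} {X1} {X2} hole s ρ e = ⊥-elim (par-not-Elementary {A} {B} {X1} {X2} (subst Elementary (sym e) (Elementary-varApp k s ρ)))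
AHeadedBelow-par {k} (inL A' B' D1 w) s ρ e with par-injective e
... | refl , refl , e1 , refl = inj₁ (D1 , refl , trans e1 (cong (λ n → plug D1 (varApp n s ρ)) (sym (+-suc (depth D1) k))))
AHeadedBelow-par {k} (inR A' B' w D2) s ρ e with par-injective e
... | refl , refl , refl , e2 = inj₂ (D2 , refl , trans e2 (cong (λ n → plug D2 (varApp n s ρ)) (sym (+-suc (depth D2) k))))

AHeadedBelow-inL : ∀ {k A B X1 X2} D1 s ρ → AHeadedBelow (suc k) X1 D1 s ρ → AHeadedBelow k (par A B X1 X2) (inL A B D1 X2) s ρ
AHeadedBelow-inL {k} {A} {B} {X1} {X2} D1 s ρ e = cong (λ x → par A B x X2) (trans e (cong (λ n → plug D1 (varApp n s ρ)) (+-suc (depth D1) k)))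

AHeadedBelow-inR : ∀ {k A B X1 X2} D2 s ρ → AHeadedBelow (suc k) X2 D2 s ρ → AHeadedBelow k (par A B X1 X2) (inR A B X1 D2) s ρ
AHeadedBelow-inR {k} {A} {B} {X1} {X2} D2 s ρ e = cong (par A B X1) (trans e (cong (λ n → plug D2 (varApp n s ρ)) (+-suc (depth D2) k)))

IsVarApp : ℕ → PT → List Elim → Set
IsVarApp k h0 σ0 = Σ PT λ s → Σ (List Elim) λ ρ → h0 ≡ pv k × σ0 ≡ argP s ∷ ρ

isVarApp?-stack : ∀ k σ0 → IsVarApp k (pv k) σ0 ⊎ ¬ IsVarApp k (pv k) σ0
isVarApp?-stack k [] = inj₂ λ { (_ , _ , _ , ()) }
isVarApp?-stack k (argP s ∷ ρ) = inj₁ (s , ρ , refl , refl)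
isVarApp?-stack k (argT m ∷ ρ) = inj₂ λ { (_ , _ , _ , ()) }
isVarApp?-stack k (prj0 ∷ ρ) = inj₂ λ { (_ , _ , _ , ()) }
isVarApp?-stack k (prj1 ∷ ρ) = inj₂ λ { (_ , _ , _ , ()) }
isVarApp?-stack k (case A B w₁ w₂ ∷ ρ) = inj₂ λ { (_ , _ , _ , ()) }
isVarApp?-stack k (exE A w ∷ ρ) = inj₂ λ { (_ , _ , _ , ()) }

isVarApp? : ∀ k h0 σ0 → IsVarApp k h0 σ0 ⊎ ¬ IsVarApp k h0 σ0
isVarApp? k h0 σ0 with pv? h0
... | inj₂ nv = inj₂ λ { (s , ρ , e1 , _) → nv k e1 }
... | inj₁ (j , refl) with j ≟ k
...   | no ne = inj₂ λ { (s , ρ , refl , _) → ne refl }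
...   | yes refl = isVarApp?-stack k σ0

leftmostBelow?-Elementary : ∀ k X → Elementary X → LeftmostBelow? k X
leftmostBelow?-Elementary k X n with ◂-decompose X
... | h0 , σ0 , na , e with isVarApp? k h0 σ0
...   | inj₁ (s , ρ , refl , refl) = inj₁ (hole , s , ρ , e , λ _ _ _ _ → z≤n)
...   | inj₂ nd = inj₂ λ D s ρ a → h D s ρ a (Elementary-plug⇒hole {C = D} n a)
  where
  h : ∀ D s ρ → AHeadedBelow k X D s ρ → D ≡ hole → ⊥
  h .hole s ρ a refl with ◂-injective {h0} {pv k} {σ0} {argP s ∷ ρ} na tt (trans (sym e) a)
  ... | e1 , e2 = nd (s , ρ , e1 , e2)

leftmostBelow?-par : ∀ {k A B X₁ X₂} → LeftmostBelow? (suc k) X₁ → LeftmostBelow? (suc k) X₂ → LeftmostBelow? k (par A B X₁ X₂)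
leftmostBelow?-par {k} {A} {B} {X₁} {X₂} (inj₁ (D , s , ρ , a , mn)) _ = inj₁ (inL A B D X₂ , s , ρ , AHeadedBelow-inL D s ρ a , minimal)
  where
  minimal : ∀ D' s' ρ' → AHeadedBelow k (par A B X₁ X₂) D' s' ρ' → left D ≤ left D'
  minimal D' s' ρ' a' with AHeadedBelow-par D' s' ρ' a'
  ... | inj₁ (D₁ , refl , a₁) = mn D₁ s' ρ' a₁
  ... | inj₂ (D₂ , refl , _) = <⇒≤ (<-≤-trans (subst (λ z → left D < nproc z) (sym a) (left<nproc-plug D _)) (m≤m+n (nproc X₁) (left D₂)))
leftmostBelow?-par {k} {A} {B} {X₁} {X₂} (inj₂ none₁) (inj₁ (D , s , ρ , a , mn)) = inj₁ (inR A B X₁ D , s , ρ , AHeadedBelow-inR D s ρ a , minimal)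
  where
  minimal : ∀ D' s' ρ' → AHeadedBelow k (par A B X₁ X₂) D' s' ρ' → nproc X₁ + left D ≤ left D'
  minimal D' s' ρ' a' with AHeadedBelow-par D' s' ρ' a'
  ... | inj₁ (D₁ , refl , a₁) = ⊥-elim (none₁ D₁ s' ρ' a₁)
  ... | inj₂ (D₂ , refl , a₂) = +-monoʳ-≤ (nproc X₁) (mn D₂ s' ρ' a₂)
leftmostBelow?-par {k} {A} {B} {X₁} {X₂} (inj₂ none₁) (inj₂ none₂) = inj₂ none
  where
  none : ∀ D s ρ → ¬ AHeadedBelow k (par A B X₁ X₂) D s ρ
  none D s ρ a with AHeadedBelow-par D s ρ a
  ... | inj₁ (D₁ , refl , a₁) = none₁ D₁ s ρ a₁
  ... | inj₂ (D₂ , refl , a₂) = none₂ D₂ s ρ a₂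

leftmostBelow? : ∀ k X → LeftmostBelow? k X
leftmostBelow? k X with par-or-Elementary X
... | inj₂ n = leftmostBelow?-Elementary k X n
leftmostBelow? k .(par A B X₁ X₂) | inj₁ (A , B , X₁ , X₂ , refl) =
  leftmostBelow?-par (leftmostBelow? (suc k) X₁) (leftmostBelow? (suc k) X₂)

HasLeftmost : PT → Set
HasLeftmost X = Σ PCtx λ D → Σ PT λ s → Σ (List Elim) λ ρ → Leftmost X D s ρ

leftmost? : ∀ X → HasLeftmost X ⊎ NotAHeaded X
leftmost? X with leftmostBelow? 0 X
... | inj₁ (D , s , ρ , a , mn) = inj₁ (D , s , ρ , AHeadedBelow→AHeaded X D s ρ a , λ D' s' ρ' a' → mn D' s' ρ' (AHeaded→AHeadedBelow X D' s' ρ' a'))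
... | inj₂ none = inj₂ λ D s ρ a → none D s ρ (AHeaded→AHeadedBelow X D s ρ a)

Leftmost-≤ : ∀ X D s ρ → AHeaded X D s ρ → Σ PCtx λ D' → Σ PT λ s' → Σ (List Elim) λ ρ' → Leftmost X D' s' ρ' × left D' ≤ left D
Leftmost-≤ X D s ρ a with leftmost? X
... | inj₁ (D' , s' , ρ' , lm@(_ , mn)) = D' , s' , ρ' , lm , mn D s ρ a
... | inj₂ nh = ⊥-elim (nh D s ρ a)

-- No contraction reproduces its redex

mutual
  size : PT → ℕ
  size (pv i) = 1
  size (t · ξ) = suc (size t + sizeE ξ)
  size (pair u t) = suc (size u + size t)
  size (lam A u) = suc (size u)
  size (inj0 B u) = suc (size u)
  size (inj1 A u) = suc (size u)
  size (Lam u) = suc (size u)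
  size (wit A m u) = suc (size u)
  size (par A B u v) = suc (size u + size v)
  size (efq P u) = suc (size u)
  size (abort A B) = 1

  sizeE : Elim → ℕ
  sizeE (argP u) = suc (size u)
  sizeE (argT m) = 1
  sizeE prj0 = 1
  sizeE prj1 = 1
  sizeE (case A B w₁ w₂) = suc (size w₁ + size w₂)
  sizeE (exE A w) = suc (size w)

mutual
  size-substIP : ∀ ρ t → size (substIP ρ t) ≡ size t
  size-substIP ρ (pv i) = refl
  size-substIP ρ (t · ξ) = cong₂ (λ a b → suc (a + b)) (size-substIP ρ t) (sizeE-substIE ρ ξ)
  size-substIP ρ (pair u t) = cong₂ (λ a b → suc (a + b)) (size-substIP ρ u) (size-substIP ρ t)
  size-substIP ρ (lam A u) = cong suc (size-substIP ρ u)
  size-substIP ρ (inj0 B u) = cong suc (size-substIP ρ u)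
  size-substIP ρ (inj1 A u) = cong suc (size-substIP ρ u)
  size-substIP ρ (Lam u) = cong suc (size-substIP (liftT ρ) u)
  size-substIP ρ (wit A m u) = cong suc (size-substIP ρ u)
  size-substIP ρ (par A B u v) = cong₂ (λ a b → suc (a + b)) (size-substIP ρ u) (size-substIP ρ v)
  size-substIP ρ (efq P u) = cong suc (size-substIP ρ u)
  size-substIP ρ (abort A B) = refl

  sizeE-substIE : ∀ ρ ξ → sizeE (substIE ρ ξ) ≡ sizeE ξ
  sizeE-substIE ρ (argP u) = cong suc (size-substIP ρ u)
  sizeE-substIE ρ (argT m) = refl
  sizeE-substIE ρ prj0 = refl
  sizeE-substIE ρ prj1 = refl
  sizeE-substIE ρ (case A B w₁ w₂) = cong₂ (λ a b → suc (a + b)) (size-substIP ρ w₁) (size-substIP ρ w₂)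
  sizeE-substIE ρ (exE A w) = cong suc (size-substIP (liftT ρ) w)

size-<-· : ∀ t ξ → size t < size (t · ξ)
size-<-· t ξ = s≤s (m≤m+n (size t) (sizeE ξ))

size-<-argP : ∀ t u → size u < size (t · argP u)
size-<-argP t u = s≤s (≤-trans (n≤1+n (size u)) (m≤n+m (suc (size u)) (size t)))

size-≤-◂ : ∀ t σ → size t ≤ size (t ◂ σ)
size-≤-◂ t [] = ≤-refl
size-≤-◂ t (ξ ∷ σ) = ≤-trans (<⇒≤ (size-<-· t ξ)) (size-≤-◂ (t · ξ) σ)

size-<⇒≢ : ∀ {t u} → size t < size u → t ≢ u
size-<⇒≢ lt refl = <-irrefl refl lt

size-<-head⇒≢ : ∀ {t} F {ξ} → size t < size F → t ≢ F · ξ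
size-<-head⇒≢ F {ξ} lt = size-<⇒≢ (<-trans lt (size-<-· F ξ))

pv-injective : ∀ {i j} → pv i ≡ pv j → i ≡ j
pv-injective refl = refl

·-injective : ∀ {t u ξ ζ} → t · ξ ≡ u · ζ → t ≡ u × ξ ≡ ζ
·-injective refl = refl , refl

lam-injective : ∀ {A B t u} → lam A t ≡ lam B u → A ≡ B × t ≡ u
lam-injective refl = refl , refl

case-injective : ∀ {A B a b A' B' a' b'} → case A B a b ≡ case A' B' a' b' → A ≡ A' × B ≡ B' × a ≡ a' × b ≡ b'
case-injective refl = refl , refl , refl , refl

exE-injective : ∀ {A a A' a'} → exE A a ≡ exE A' a' → A ≡ A' × a ≡ a'
exE-injective refl = refl , refl

A≢A⇒B : ∀ A B → A ≢ (A ⇒ B)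
A≢A⇒B (A ⇒ A') B e = A≢A⇒B A A' (proj₁ (⇒-injective e))
A≢A⇒B (atom _ _) B ()
A≢A⇒B ⊥' B ()
A≢A⇒B (_ ∧' _) B ()
A≢A⇒B (_ ∨' _) B ()
A≢A⇒B (∀' _) B ()
A≢A⇒B (∃' _) B ()

◂-cancelʳ : ∀ {t u} σ → t ◂ σ ≡ u ◂ σ → t ≡ u
◂-cancelʳ [] e = e
◂-cancelʳ (ξ ∷ σ) e = proj₁ (·-injective (◂-cancelʳ σ e))

renP-≡-· : ∀ ρ t {F Ξ} → renP ρ t ≡ F · Ξ → Σ PT λ f → Σ Elim λ ξ → t ≡ f · ξ × renP ρ f ≡ F × renE ρ ξ ≡ Ξ
renP-≡-· ρ (f · ξ) refl = f , ξ , refl , refl , refl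
renP-≡-· ρ (pv _) ()
renP-≡-· ρ (pair _ _) ()
renP-≡-· ρ (lam _ _) ()
renP-≡-· ρ (inj0 _ _) ()
renP-≡-· ρ (inj1 _ _) ()
renP-≡-· ρ (Lam _) ()
renP-≡-· ρ (wit _ _ _) ()
renP-≡-· ρ (par _ _ _ _) ()
renP-≡-· ρ (efq _ _) ()
renP-≡-· ρ (abort _ _) ()

renP-≡-lam : ∀ ρ t {A c} → renP ρ t ≡ lam A c → Σ PT λ b → t ≡ lam A b × renP (liftR ρ) b ≡ c
renP-≡-lam ρ (lam A b) refl = b , refl , refl
renP-≡-lam ρ (pv _) ()
renP-≡-lam ρ (_ · _) ()
renP-≡-lam ρ (pair _ _) ()
renP-≡-lam ρ (inj0 _ _) ()
renP-≡-lam ρ (inj1 _ _) ()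
renP-≡-lam ρ (Lam _) ()
renP-≡-lam ρ (wit _ _ _) ()
renP-≡-lam ρ (par _ _ _ _) ()
renP-≡-lam ρ (efq _ _) ()
renP-≡-lam ρ (abort _ _) ()

renP-liftR-≡-pv-suc : ∀ b {j} → renP (liftR suc) b ≡ pv (suc j) → Σ ℕ λ y → j ≡ suc y × b ≡ pv j
renP-liftR-≡-pv-suc b e with renP-≡-pv (liftR suc) b e
... | zero , _ , ()
... | suc y , refl , refl = y , refl , refl

renE-≡-argP : ∀ ρ ξ {W} → renE ρ ξ ≡ argP W → Σ PT λ w → ξ ≡ argP w
renE-≡-argP ρ (argP w) refl = w , refl
renE-≡-argP ρ (argT _) ()
renE-≡-argP ρ prj0 ()
renE-≡-argP ρ prj1 ()
renE-≡-argP ρ (case _ _ _ _) ()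
renE-≡-argP ρ (exE _ _) ()

renE-≡-case : ∀ ρ ξ {A B c W} → renE ρ ξ ≡ case A B c W →
  Σ PT λ c₀ → Σ PT λ W₀ → ξ ≡ case A B c₀ W₀ × renP (liftR ρ) c₀ ≡ c × renP (liftR ρ) W₀ ≡ W
renE-≡-case ρ (case A B c₀ W₀) refl = c₀ , W₀ , refl , refl , refl
renE-≡-case ρ (argP _) ()
renE-≡-case ρ (argT _) ()
renE-≡-case ρ prj0 ()
renE-≡-case ρ prj1 ()
renE-≡-case ρ (exE _ _) ()

renE-≡-exE : ∀ ρ ξ {A c} → renE ρ ξ ≡ exE A c → Σ PT λ c₀ → ξ ≡ exE A c₀ × renP (liftR ρ) c₀ ≡ c
renE-≡-exE ρ (exE A c₀) refl = c₀ , refl , refl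
renE-≡-exE ρ (argP _) ()
renE-≡-exE ρ (argT _) ()
renE-≡-exE ρ prj0 ()
renE-≡-exE ρ prj1 ()
renE-≡-exE ρ (case _ _ _ _) ()

substIP-≡-pv : ∀ ρ t {j} → substIP ρ t ≡ pv j → t ≡ pv j
substIP-≡-pv ρ (pv _) refl = refl
substIP-≡-pv ρ (_ · _) ()
substIP-≡-pv ρ (pair _ _) ()
substIP-≡-pv ρ (lam _ _) ()
substIP-≡-pv ρ (inj0 _ _) ()
substIP-≡-pv ρ (inj1 _ _) ()
substIP-≡-pv ρ (Lam _) ()
substIP-≡-pv ρ (wit _ _ _) ()
substIP-≡-pv ρ (par _ _ _ _) ()
substIP-≡-pv ρ (efq _ _) ()
substIP-≡-pv ρ (abort _ _) ()

substIP-≡-· : ∀ ρ t {F Ξ} → substIP ρ t ≡ F · Ξ → Σ PT λ f → Σ Elim λ ξ → t ≡ f · ξ × substIP ρ f ≡ F × substIE ρ ξ ≡ Ξ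
substIP-≡-· ρ (f · ξ) refl = f , ξ , refl , refl , refl
substIP-≡-· ρ (pv _) ()
substIP-≡-· ρ (pair _ _) ()
substIP-≡-· ρ (lam _ _) ()
substIP-≡-· ρ (inj0 _ _) ()
substIP-≡-· ρ (inj1 _ _) ()
substIP-≡-· ρ (Lam _) ()
substIP-≡-· ρ (wit _ _ _) ()
substIP-≡-· ρ (par _ _ _ _) ()
substIP-≡-· ρ (efq _ _) ()
substIP-≡-· ρ (abort _ _) ()

substIE-≡-exE : ∀ ρ ξ {A c} → substIE ρ ξ ≡ exE A c → Σ Fm λ A₀ → Σ PT λ c₀ → ξ ≡ exE A₀ c₀ × substIP (liftT ρ) c₀ ≡ c
substIE-≡-exE ρ (exE A₀ c₀) refl = A₀ , c₀ , refl , refl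
substIE-≡-exE ρ (argP _) ()
substIE-≡-exE ρ (argT _) ()
substIE-≡-exE ρ prj0 ()
substIE-≡-exE ρ prj1 ()
substIE-≡-exE ρ (case _ _ _ _) ()

substP-≡-· : ∀ σ c {F Ξ} → substP σ c ≡ F · Ξ → (Σ ℕ λ j → c ≡ pv j) ⊎ (Σ PT λ f → Σ Elim λ ξ → c ≡ f · ξ)
substP-≡-· σ (pv j) _ = inj₁ (j , refl)
substP-≡-· σ (f · ξ) _ = inj₂ (f , ξ , refl)
substP-≡-· σ (pair _ _) ()
substP-≡-· σ (lam _ _) ()
substP-≡-· σ (inj0 _ _) ()
substP-≡-· σ (inj1 _ _) ()
substP-≡-· σ (Lam _) ()
substP-≡-· σ (wit _ _ _) ()
substP-≡-· σ (par _ _ _ _) ()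
substP-≡-· σ (efq _ _) ()
substP-≡-· σ (abort _ _) ()

substP-≡-lam : ∀ σ c {A x} → substP σ c ≡ lam A x → (Σ ℕ λ j → c ≡ pv j) ⊎ (Σ PT λ b → c ≡ lam A b)
substP-≡-lam σ (pv j) _ = inj₁ (j , refl)
substP-≡-lam σ (lam A b) refl = inj₂ (b , refl)
substP-≡-lam σ (_ · _) ()
substP-≡-lam σ (pair _ _) ()
substP-≡-lam σ (inj0 _ _) ()
substP-≡-lam σ (inj1 _ _) ()
substP-≡-lam σ (Lam _) ()
substP-≡-lam σ (wit _ _ _) ()
substP-≡-lam σ (par _ _ _ _) ()
substP-≡-lam σ (efq _ _) ()
substP-≡-lam σ (abort _ _) ()

substE-≡-case : ∀ σ ξ {A B c W} → substE σ ξ ≡ case A B c W → Σ PT λ c₁ → Σ PT λ c₂ → ξ ≡ case A B c₁ c₂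
substE-≡-case σ (case A B c₁ c₂) refl = c₁ , c₂ , refl
substE-≡-case σ (argP _) ()
substE-≡-case σ (argT _) ()
substE-≡-case σ prj0 ()
substE-≡-case σ prj1 ()
substE-≡-case σ (exE _ _) ()

substE-≡-exE : ∀ σ ξ {A c} → substE σ ξ ≡ exE A c → Σ PT λ c₁ → ξ ≡ exE A c₁
substE-≡-exE σ (exE A c₁) refl = c₁ , refl
substE-≡-exE σ (argP _) ()
substE-≡-exE σ (argT _) ()
substE-≡-exE σ prj0 ()
substE-≡-exE σ prj1 ()
substE-≡-exE σ (case _ _ _ _) ()

substP-substIP-≡-· : ∀ σ ρ c {F Ξ} → substP σ (substIP ρ c) ≡ F · Ξ →
  (Σ ℕ λ j → c ≡ pv j) ⊎ (Σ PT λ f → Σ Elim λ ξ → c ≡ f · ξ)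
substP-substIP-≡-· σ ρ c e with substP-≡-· σ (substIP ρ c) e
... | inj₁ (j , eq) = inj₁ (j , substIP-≡-pv ρ c eq)
... | inj₂ (_ , _ , eq) with substIP-≡-· ρ c eq
...   | f , ξ , eq' , _ = inj₂ (f , ξ , eq')

substE-substIE-≡-exE : ∀ σ ρ ξ {A c} → substE σ (substIE ρ ξ) ≡ exE A c → Σ Fm λ A₁ → Σ PT λ c₁ → ξ ≡ exE A₁ c₁
substE-substIE-≡-exE σ ρ ξ e with substE-≡-exE σ (substIE ρ ξ) e
... | _ , eq with substIE-≡-exE ρ ξ eq
...   | A₁ , c₁ , eq' , _ = A₁ , c₁ , eq'

-- A contractum can only equal its redex if substituting into the body rebuilds the
-- redex around the substituted variable.  Following the body down, such a loop ends
-- at a variable j whose image has one of the shapes below.  Lifting preserves their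
-- absence, since an image renamed by suc never contains index 1 under one binder.
NoλLoop : (ℕ → PT) → ℕ → Set
NoλLoop σ j = (∀ A W → σ j ≢ lam A (pv j) · argP W) × (∀ A W → σ j ≢ lam A (pv j · argP W))

NoCaseˡLoop : (ℕ → PT) → ℕ → Set
NoCaseˡLoop σ j = ∀ Y A B W → σ j ≢ Y · case A B (pv j) W

NoCaseʳLoop : (ℕ → PT) → ℕ → Set
NoCaseʳLoop σ j = ∀ Y A B W → σ j ≢ Y · case A B W (pv j)

No∃Loop : (ℕ → PT) → ℕ → Set
No∃Loop σ j = ∀ Y A → σ j ≢ Y · exE A (pv j)

NoλLoop-liftP : ∀ {σ} → (∀ y → NoλLoop σ (suc y)) → ∀ j → NoλLoop (liftP σ) j
NoλLoop-liftP g zero = (λ _ _ ()) , (λ _ _ ())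
NoλLoop-liftP {σ} g (suc j) = outer , inner
  where
  outer : ∀ A W → renP suc (σ j) ≢ lam A (pv (suc j)) · argP W
  outer A W e with renP-≡-· suc (σ j) e
  ... | f , ξ , eσ , ef , eξ with renP-≡-lam suc f ef | renE-≡-argP suc ξ eξ
  ...   | b , refl , eb | w , refl with renP-liftR-≡-pv-suc b eb
  ...     | y , refl , refl = proj₁ (g y) A w eσ
  inner : ∀ A W → renP suc (σ j) ≢ lam A (pv (suc j) · argP W)
  inner A W e with renP-≡-lam suc (σ j) e
  ... | b , eσ , eb with renP-≡-· (liftR suc) b eb
  ...   | f , ξ , refl , ef , eξ with renP-≡-pv (liftR suc) f ef | renE-≡-argP (liftR suc) ξ eξ
  ...     | suc y , refl , refl | w , refl = proj₂ (g y) A w eσ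

NoCaseˡLoop-liftP : ∀ {σ} → (∀ y → NoCaseˡLoop σ (suc y)) → ∀ j → NoCaseˡLoop (liftP σ) j
NoCaseˡLoop-liftP g zero Y A B W ()
NoCaseˡLoop-liftP {σ} g (suc j) Y A B W e with renP-≡-· suc (σ j) e
... | f , ξ , eσ , _ , eξ with renE-≡-case suc ξ eξ
...   | c₀ , W₀ , refl , ec , _ with renP-liftR-≡-pv-suc c₀ ec
...     | y , refl , refl = g y f A B W₀ eσ

NoCaseʳLoop-liftP : ∀ {σ} → (∀ y → NoCaseʳLoop σ (suc y)) → ∀ j → NoCaseʳLoop (liftP σ) j
NoCaseʳLoop-liftP g zero Y A B W ()
NoCaseʳLoop-liftP {σ} g (suc j) Y A B W e with renP-≡-· suc (σ j) e
... | f , ξ , eσ , _ , eξ with renE-≡-case suc ξ eξ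
...   | c₀ , W₀ , refl , _ , eW with renP-liftR-≡-pv-suc W₀ eW
...     | y , refl , refl = g y f A B c₀ eσ

No∃Loop-liftP-liftPI : ∀ {σ} → (∀ y → No∃Loop σ (suc y)) → ∀ j → No∃Loop (liftP (liftPI σ)) j
No∃Loop-liftP-liftPI g zero Y A ()
No∃Loop-liftP-liftPI {σ} g (suc j) Y A e with renP-≡-· suc (shiftIP (σ j)) e
... | f , ξ , eσ , _ , eξ with renE-≡-exE suc ξ eξ
...   | c₀ , refl , ec with renP-liftR-≡-pv-suc c₀ ec
...     | y , refl , refl with substIP-≡-· shiftσ (σ j) eσ
...       | f' , ξ' , eσ' , _ , eξ' with substIE-≡-exE shiftσ ξ' eξ'
...         | A₀ , c₀' , refl , ec' with substIP-≡-pv (liftT shiftσ) c₀' ec'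
...           | refl = g y f' A₀ eσ'

λ-loop-free : ∀ c σ {A W} → (∀ y → NoλLoop σ (suc y)) → substP (liftP σ) c ≢ lam A c · argP W
λ-loop-free c σ g e with substP-≡-· (liftP σ) c e
... | inj₁ (j , refl) = proj₁ (NoλLoop-liftP {σ} g j) _ _ e
... | inj₂ (f , ξ , refl) with ·-injective e
...   | ef , eξ with substE-≡-argP (liftP σ) ξ eξ | substP-≡-lam (liftP σ) f ef
...     | w , refl , _ | inj₁ (j , refl) = proj₂ (NoλLoop-liftP {σ} g j) _ w ef
...     | w , refl , _ | inj₂ (b , refl) =
          λ-loop-free b (liftP σ) (λ y → NoλLoop-liftP {σ} g (suc y)) (proj₂ (lam-injective ef))

caseˡ-loop-free : ∀ c σ {Y A B W} → (∀ y → NoCaseˡLoop σ (suc y)) → substP (liftP σ) c ≢ Y · case A B c W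
caseˡ-loop-free c σ g e with substP-≡-· (liftP σ) c e
... | inj₁ (j , refl) = NoCaseˡLoop-liftP {σ} g j _ _ _ _ e
... | inj₂ (f , ξ , refl) with substE-≡-case (liftP σ) ξ (proj₂ (·-injective e))
...   | c₁ , c₂ , refl with case-injective (proj₂ (·-injective e))
...     | _ , _ , e₁ , _ = caseˡ-loop-free c₁ (liftP σ) (λ y → NoCaseˡLoop-liftP {σ} g (suc y)) e₁

caseʳ-loop-free : ∀ c σ {Y A B W} → (∀ y → NoCaseʳLoop σ (suc y)) → substP (liftP σ) c ≢ Y · case A B W c
caseʳ-loop-free c σ g e with substP-≡-· (liftP σ) c e
... | inj₁ (j , refl) = NoCaseʳLoop-liftP {σ} g j _ _ _ _ e
... | inj₂ (f , ξ , refl) with substE-≡-case (liftP σ) ξ (proj₂ (·-injective e))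
...   | c₁ , c₂ , refl with case-injective (proj₂ (·-injective e))
...     | _ , _ , _ , e₂ = caseʳ-loop-free c₂ (liftP σ) (λ y → NoCaseʳLoop-liftP {σ} g (suc y)) e₂

∃-loop-free : ∀ c σ ρ {Y A} → (∀ j → No∃Loop σ j) → substP σ (substIP ρ c) ≢ Y · exE A c
∃-loop-free c σ ρ g e with substP-substIP-≡-· σ ρ c e
... | inj₁ (j , refl) = g j _ _ e
... | inj₂ (f , ξ , refl) with substE-substIE-≡-exE σ ρ ξ (proj₂ (·-injective e))
...   | _ , c₁ , refl =
        ∃-loop-free c₁ (liftP (liftPI σ)) (liftT ρ) (No∃Loop-liftP-liftPI {σ} (λ y → g (suc y)))
          (proj₂ (exE-injective (proj₂ (·-injective e))))

-- Typing is needed here: (λx. x x) (λx. x x) contracts to itself.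
βλ-irreflexive : ∀ {Γ t A B} u → Γ ⊢ t ∶ A → Γ ⊢ lam A u ∶ (A ⇒ B) → sub1 t u ≢ lam A u · argP t
βλ-irreflexive {t = t} {A} u dt dl e with substP-≡-· (consP t) u e
... | inj₁ (zero , refl) = size-<⇒≢ (size-<-argP (lam A (pv zero)) t) e
... | inj₁ (suc i , refl) = contradiction e λ ()
... | inj₂ (f , ξ , refl) with ·-injective e
...   | ef , eξ with substE-≡-argP (consP t) ξ eξ | substP-≡-lam (consP t) f ef
...     | _ | inj₁ (zero , refl) = A≢A⇒B _ _ (⊢-unique (subst (λ z → _ ⊢ z ∶ _) ef dt) dl)
...     | _ | inj₁ (suc i , refl) = contradiction ef λ ()
...     | w , refl , _ | inj₂ (b , refl) =
          λ-loop-free b (consP t) (λ _ → (λ _ _ ()) , (λ _ _ ())) (proj₂ (lam-injective ef))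

βι0-irreflexive : ∀ {B A' B' u} w₀ {w₁} → sub1 u w₀ ≢ inj0 B u · case A' B' w₀ w₁
βι0-irreflexive {B} {u = u} w₀ e with substP-≡-· (consP u) w₀ e
... | inj₁ (zero , refl) = size-<-head⇒≢ (inj0 B u) (s≤s ≤-refl) e
... | inj₁ (suc i , refl) = contradiction e λ ()
... | inj₂ (f , ξ , refl) with substE-≡-case (consP u) ξ (proj₂ (·-injective e))
...   | c₁ , c₂ , refl with case-injective (proj₂ (·-injective e))
...     | _ , _ , e₁ , _ = caseˡ-loop-free c₁ (consP u) (λ _ _ _ _ _ ()) e₁

βι1-irreflexive : ∀ {A A' B' u} w₁ {w₀} → sub1 u w₁ ≢ inj1 A u · case A' B' w₀ w₁
βι1-irreflexive {A} {u = u} w₁ e with substP-≡-· (consP u) w₁ e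
... | inj₁ (zero , refl) = size-<-head⇒≢ (inj1 A u) (s≤s ≤-refl) e
... | inj₁ (suc i , refl) = contradiction e λ ()
... | inj₂ (f , ξ , refl) with substE-≡-case (consP u) ξ (proj₂ (·-injective e))
...   | c₁ , c₂ , refl with case-injective (proj₂ (·-injective e))
...     | _ , _ , _ , e₂ = caseʳ-loop-free c₂ (consP u) (λ _ _ _ _ _ ()) e₂

β∃-irreflexive : ∀ {A m u A'} v → sub1 u (isub1 m v) ≢ wit A m u · exE A' v
β∃-irreflexive {A} {m} {u} v e with substP-substIP-≡-· (consP u) (consT m) v e
... | inj₁ (zero , refl) = size-<-head⇒≢ (wit A m u) (s≤s ≤-refl) e
... | inj₁ (suc i , refl) = contradiction e λ ()
... | inj₂ (f , ξ , refl) with substE-substIE-≡-exE (consP u) (consT m) ξ (proj₂ (·-injective e))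
...   | _ , c₁ , refl =
        ∃-loop-free c₁ (liftP (liftPI (consP u))) (liftT (consT m))
          (No∃Loop-liftP-liftPI {consP u} (λ _ _ _ ())) (proj₂ (exE-injective (proj₂ (·-injective e))))

contraction-irreflexive : ∀ {Γ r ξ h T} → Γ ⊢ r · ξ ∶ T → Contr r ξ h → h ≢ r · ξ
contraction-irreflexive (⊢app (⊢lam du) dt) (βλ {u = u}) = βλ-irreflexive u dt (⊢lam du)
contraction-irreflexive _ (β∀ {u} {m}) =
  size-<⇒≢ (subst (_< size (Lam u · argT m)) (sym (size-substIP (consT m) u)) (<-trans (s≤s ≤-refl) (size-<-· (Lam u) (argT m))))
contraction-irreflexive _ (βπ0 {u₀} {u₁}) = size-<⇒≢ (<-trans (s≤s (m≤m+n (size u₀) (size u₁))) (size-<-· (pair u₀ u₁) prj0))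
contraction-irreflexive _ (βπ1 {u₀} {u₁}) = size-<⇒≢ (<-trans (s≤s (m≤n+m (size u₁) (size u₀))) (size-<-· (pair u₀ u₁) prj1))
contraction-irreflexive _ (βι0 {w₀ = w₀}) = βι0-irreflexive w₀
contraction-irreflexive _ (βι1 {w₁ = w₁}) = βι1-irreflexive w₁
contraction-irreflexive _ (β∃ {v = v}) = β∃-irreflexive v
contraction-irreflexive _ (∥ξ _) ()

step-irreflexive : ∀ {Γ p q T} → Γ ⊢ p ∶ T → ProcStep Γ p q → q ≢ p
step-irreflexive d (basic {r} {ξ} {h} {σ} c) e with ⊢-◂-head {t = r · ξ} {σ = σ} d
... | _ , d' = contraction-irreflexive d' c (◂-cancelʳ σ e)
step-irreflexive d (abortS {A} {B} {u} {σ} dt du) =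
  size-<⇒≢ (<-≤-trans (size-<-argP (abort A B) u) (size-≤-◂ (abort A B · argP u) σ))

-- Simulating a head step of u ∥ v

crossσ : Fm → PT → ℕ → ℕ → PT
crossσ D s k zero = lam D (renP suc s)
crossσ D s k (suc i) = pv (k + suc i)

crossSub≡substP : ∀ D v s k → crossSub D v s k ≡ substP (crossσ D s k) v
crossSub≡substP D v s k = substP-cong (λ { zero → refl ; (suc i) → refl }) v

crossSub-◂ : ∀ Q s k h σ → crossSub Q (h ◂ σ) s k ≡ substP (crossσ Q s k) h ◂ map (substE (crossσ Q s k)) σ
crossSub-◂ Q s k h σ = trans (crossSub≡substP Q (h ◂ σ) s k) (substP-◂ (crossσ Q s k) h σ)

crossSub-not-varApp : ∀ Q Y s k s' ρ → crossSub Q Y s k ≢ varApp k s' ρ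
crossSub-not-varApp Q Y s k s' ρ e with ◂-decompose Y
... | h , σ , na , refl with pv? h | trans (sym (crossSub-◂ Q s k h σ)) e
...   | inj₁ (zero , refl) | e' with ◂-injective {lam Q (renP suc s)} {pv k} {map (substE (crossσ Q s k)) σ} {argP s' ∷ ρ} tt tt e'
...     | () , _
crossSub-not-varApp Q Y s k s' ρ e | h , σ , na , refl | inj₁ (suc i , refl) | e' =
  m+1+n≢m k (pv-injective (proj₁ (◂-injective {pv (k + suc i)} {pv k} {map (substE (crossσ Q s k)) σ} {argP s' ∷ ρ} tt tt e')))
crossSub-not-varApp Q Y s k s' ρ e | h , σ , na , refl | inj₂ nv | e' =
  substP-≢pv _ h nv (proj₁ (◂-injective {substP (crossσ Q s k) h} {pv k} {map (substE (crossσ Q s k)) σ} {argP s' ∷ ρ} (NotApp-substP _ h na nv) tt e'))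

substP-crossSub : ∀ τ Q v s k → substP (liftPN k (liftP τ)) (crossSub Q v s k) ≡ crossSub Q (substP (liftP τ) v) (substP (liftPN k (liftP τ)) s) k
substP-crossSub τ Q v s k = begin
  substP τₖ (crossSub Q v s k)                         ≡⟨ cong (substP τₖ) (crossSub≡substP Q v s k) ⟩
  substP τₖ (substP (crossσ Q s k) v)                  ≡⟨ substP-∘ (crossσ Q s k) τₖ v ⟩
  substP (crossσ Q s k ⨾ τₖ) v                         ≡⟨ substP-cong pointwise v ⟩
  substP (liftP τ ⨾ crossσ Q (substP τₖ s) k) v        ≡⟨ sym (substP-∘ (liftP τ) (crossσ Q (substP τₖ s) k) v) ⟩
  substP (crossσ Q (substP τₖ s) k) (substP (liftP τ) v) ≡⟨ sym (crossSub≡substP Q (substP (liftP τ) v) (substP τₖ s) k) ⟩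
  crossSub Q (substP (liftP τ) v) (substP τₖ s) k      ∎
  where
  τₖ = liftPN k (liftP τ)
  pointwise : (crossσ Q s k ⨾ τₖ) ≗ (liftP τ ⨾ crossσ Q (substP τₖ s) k)
  pointwise zero = cong (lam Q) (trans (substP-renP (liftP τₖ) suc s) (sym (renP-substP suc τₖ s)))
  pointwise (suc i) = trans (liftPN-+ k (liftP τ) (suc i))
    (trans (renP-∘ (k +_) suc (τ i)) (trans (renP≡substP (λ x → k + suc x) (τ i)) (sym (substP-renP (crossσ Q (substP τₖ s) k) suc (τ i)))))

substP-plug-crossSub : ∀ τ D Q v s →
  substP (liftP τ) (plug D (crossSub Q v s (depth D))) ≡
  plug (substCtx (liftP τ) D) (crossSub Q (substP (liftP τ) v) (substP (liftPN (depth D) (liftP τ)) s) (depth (substCtx (liftP τ) D)))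
substP-plug-crossSub τ D Q v s = begin
  substP (liftP τ) (plug D (crossSub Q v s (depth D)))
    ≡⟨ substP-plug (liftP τ) D _ ⟩
  plug (substCtx (liftP τ) D) (substP (liftPN (depth D) (liftP τ)) (crossSub Q v s (depth D)))
    ≡⟨ cong (plug (substCtx (liftP τ) D)) (substP-crossSub τ Q v s (depth D)) ⟩
  plug (substCtx (liftP τ) D) (crossSub Q (substP (liftP τ) v) (substP (liftPN (depth D) (liftP τ)) s) (depth D))
    ≡⟨ cong (λ k → plug (substCtx (liftP τ) D) (crossSub Q (substP (liftP τ) v) (substP (liftPN (depth D) (liftP τ)) s) k))
            (sym (depth-substCtx (liftP τ) D)) ⟩
  plug (substCtx (liftP τ) D) (crossSub Q (substP (liftP τ) v) (substP (liftPN (depth D) (liftP τ)) s) (depth (substCtx (liftP τ) D)))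
    ∎

scrσ : Fm → ℕ → PT
scrσ Q zero = lam Q (pv 1)
scrσ Q (suc i) = pv (suc i)

-- 𝒜 and 𝔅 with the two sides as parameters.
Scr : Fm → Fm → Fm → PT → PT
Scr P Q C Y = lam P (abort C Q · argP (substP (scrσ Q) Y))

scrA≡Scr : ∀ A B C v → scrA A B C v ≡ Scr A B C v
scrA≡Scr A B C v = cong (λ z → lam A (abort C B · argP z)) (substP-cong (λ { zero → refl ; (suc i) → refl }) v)

scrB≡Scr : ∀ A B C u → scrB A B C u ≡ Scr B A C u
scrB≡Scr A B C u = cong (λ z → lam B (abort C A · argP z)) (substP-cong (λ { zero → refl ; (suc i) → refl }) u)

TypedSub-scrσ : ∀ {Γ P Q} → TypedSub ((Q ⇒ P) ∷ Γ) (P ∷ Γ) (scrσ Q)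
TypedSub-scrσ here = ⊢lam (⊢var (there here))
TypedSub-scrσ (there x) = ⊢var (there x)

⊢-Scr : ∀ {Γ P Q C Y} → ((Q ⇒ P) ∷ Γ) ⊢ Y ∶ C → Γ ⊢ Scr P Q C Y ∶ (P ⇒ Q)
⊢-Scr dY = ⊢lam (⊢app ⊢abort (⊢-substP TypedSub-scrσ dY))

Scr-VarsButλ : ∀ P Q C Y → VarsButλ (consP (Scr P Q C Y)) 0
Scr-VarsButλ P Q C Y zero = inj₂ (refl , P , _ , refl)
Scr-VarsButλ P Q C Y (suc j) = inj₁ (j , refl)

substP-Scr-varApp : ∀ P Q C Y d s ρ → let τ = liftPN d (consP (Scr P Q C Y)) in
  substP τ (varApp d s ρ) ≡ (lam P (abort C Q · argP (renP (liftR (d +_)) (substP (scrσ Q) Y))) · argP (substP τ s)) ◂ map (substE τ) ρ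
substP-Scr-varApp P Q C Y d s ρ =
  trans (substP-◂ τ (pv d · argP s) ρ) (cong (λ z → (z · argP (substP τ s)) ◂ map (substE τ) ρ) τd)
  where
  τ = liftPN d (consP (Scr P Q C Y))
  τd : τ d ≡ renP (d +_) (Scr P Q C Y)
  τd = trans (cong τ (sym (+-identityʳ d))) (liftPN-+ d (consP (Scr P Q C Y)) 0)

sub1-scrσ : ∀ t Q Y d s → let τ = liftPN d (consP t) in
  sub1 (substP τ s) (renP (liftR (d +_)) (substP (scrσ Q) Y)) ≡ substP τ (crossSub Q Y s d)
sub1-scrσ t Q Y d s = begin
  sub1 s* (renP (liftR (d +_)) (substP (scrσ Q) Y))        ≡⟨ substP-renP (consP s*) (liftR (d +_)) (substP (scrσ Q) Y) ⟩
  substP (consP s* ∘ liftR (d +_)) (substP (scrσ Q) Y)     ≡⟨ substP-∘ (scrσ Q) (consP s* ∘ liftR (d +_)) Y ⟩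
  substP (scrσ Q ⨾ (consP s* ∘ liftR (d +_))) Y            ≡⟨ substP-cong pointwise Y ⟩
  substP (crossσ Q s d ⨾ τ) Y                             ≡⟨ sym (substP-∘ (crossσ Q s d) τ Y) ⟩
  substP τ (substP (crossσ Q s d) Y)                       ≡⟨ cong (substP τ) (sym (crossSub≡substP Q Y s d)) ⟩
  substP τ (crossSub Q Y s d)                              ∎
  where
  τ = liftPN d (consP t)
  s* = substP τ s
  pointwise : (scrσ Q ⨾ (consP s* ∘ liftR (d +_))) ≗ (crossσ Q s d ⨾ τ)
  pointwise zero = cong (lam Q) (sym (trans (substP-renP (liftP τ) suc s) (sym (renP-substP suc τ s))))
  pointwise (suc i) = sym (liftPN-+ d (consP t) (suc i))

⊢-unfold-abort : ∀ {Δ P Q C W s ρ T} → Δ ⊢ (lam P (abort C Q · argP W) · argP s) ◂ ρ ∶ T →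
  (Δ ⊢ sub1 s W ∶ C) × (Δ ⊢ (abort C Q · argP (sub1 s W)) ◂ ρ ∶ T)
⊢-unfold-abort {P = P} {Q} {C} {W} {s} {ρ} d with ⊢-◂-head {t = lam P (abort C Q · argP W) · argP s} {σ = ρ} d
... | _ , ⊢app dl@(⊢lam (⊢app ⊢abort dW)) ds =
  dZ , ⊢-◂-replace-head {t = lam P (abort C Q · argP W) · argP s} {σ = ρ} d (⊢app dl ds) (⊢app ⊢abort dZ)
  where dZ = ⊢-substP (TypedSub-consP ds) dW

crossSub-changes : ∀ {u} D s ρ Q v → Leftmost u D s ρ → plug D (crossSub Q v s (depth D)) ≢ u
crossSub-changes D s ρ Q v (ah , _) e = crossSub-not-varApp Q v s (depth D) s ρ (plug-injective D (trans e ah))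

Redex-cast : ∀ {Γ t t' m m' u u'} → t ≡ t' → m ≡ m' → u ≡ u' → Redex Γ t m u → Redex Γ t' m' u'
Redex-cast refl refl refl r = r

TypedSub-holeCtx : ∀ {Γo Γs σ} → TypedSub Γo Γs σ → ∀ C → TypedSub (holeCtx C Γo) (holeCtx C Γs) (liftPN (depth C) σ)
TypedSub-holeCtx sb hole = sb
TypedSub-holeCtx sb (inL A B C v) = TypedSub-holeCtx (TypedSub-liftP sb) C
TypedSub-holeCtx sb (inR A B u C) = TypedSub-holeCtx (TypedSub-liftP sb) C

NoRedexBefore : List Fm → PT → ℕ → Set
NoRedexBefore Γ t n = ∀ m → HasRedex Γ t m → n ≤ m

≻-intro : ∀ {Γ t n t'} → Redex Γ t n t' → NoRedexBefore Γ t n → Γ ⊢ t ≻ t'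
≻-intro {n = n} r H = n , r , λ m t' r' → H m (t' , r')

-- Head redexes left of the hole do not depend on its elementary content.
NoRedexBefore-refill : ∀ {Γ} C {q₀ q₁} → Elementary q₀ → Elementary q₁ →
  NoRedexBefore Γ (plug C q₀) (left C) → NoRedexBefore Γ (plug C q₁) (left C)
NoRedexBefore-refill C n₀ n₁ H m r with m <? left C
... | no m≮ = ≮⇒≥ m≮
... | yes m< = contradiction (H m (HasRedex-refill C n₀ n₁ r m<)) (<⇒≱ m<)

QuietBefore : List Fm → PT → ℕ → Set
QuietBefore Γ X n = NoRedexBefore Γ X n × (∀ D s ρ → AHeaded X D s ρ → n ≤ left D)

QuietBefore-inL : ∀ {Γ A B u v n} → NoRedexBefore Γ (par A B u v) n → QuietBefore ((A ⇒ B) ∷ Γ) u n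
QuietBefore-inL {u = u} H = (λ m r → H m (HasRedex-inL r)) , headed
  where
  headed : ∀ D s ρ → AHeaded u D s ρ → _
  headed D s ρ a with Leftmost-≤ u D s ρ a
  ... | D' , s' , ρ' , lm , le = ≤-trans (H _ (HasRedex-crossL D' s' ρ' lm)) le

QuietBefore-inR : ∀ {Γ A B u v n n₀} → NoRedexBefore Γ (par A B u v) n → n ≡ nproc u + n₀ → QuietBefore ((B ⇒ A) ∷ Γ) v n₀
QuietBefore-inR {u = u} {v} {n₀ = n₀} H refl = (λ m r → +-cancelˡ-≤ (nproc u) n₀ m (H _ (HasRedex-inR r))) , headed
  where
  headed : ∀ D s ρ → AHeaded v D s ρ → n₀ ≤ left D
  headed D s ρ a with leftmost? u
  ... | inj₁ (Du , su , ρu , lmu@(ahu , _)) =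
        contradiction (≤-trans (m≤m+n (nproc u) n₀) (H _ (HasRedex-crossL Du su ρu lmu)))
          (<⇒≱ (subst (λ z → left Du < nproc z) (sym ahu) (left<nproc-plug Du _)))
  ... | inj₂ nh with Leftmost-≤ v D s ρ a
  ...   | D' , s' , ρ' , lm , le = ≤-trans (+-cancelˡ-≤ (nproc u) n₀ (left D') (H _ (HasRedex-crossR D' s' ρ' nh lm))) le

module Simulation {Γ : List Fm} {P Q C : Fm} {X Y : PT}
  (dX : ((P ⇒ Q) ∷ Γ) ⊢ X ∶ C) (dY : ((Q ⇒ P) ∷ Γ) ⊢ Y ∶ C) where

  σ : ℕ → PT
  σ = consP (Scr P Q C Y)

  sh : VarsButλ σ 0
  sh = Scr-VarsButλ P Q C Y

  sb : TypedSub ((P ⇒ Q) ∷ Γ) Γ σ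
  sb = TypedSub-consP (⊢-Scr dY)

  NoRedexBefore-substP : ∀ {n} → QuietBefore ((P ⇒ Q) ∷ Γ) X n → NoRedexBefore Γ (substP σ X) n
  NoRedexBefore-substP (noRedex , noHeaded) m (_ , r) with Redex-reflect sh sb dX r
  ... | inj₁ r₀ = noRedex m r₀
  ... | inj₂ (D , s , ρ , a , le) = ≤-trans (noHeaded D s ρ (AHeadedBelow→AHeaded X D s ρ a)) le

  internal-step : ∀ C' p p' → X ≡ plug C' p → ProcStep (holeCtx C' ((P ⇒ Q) ∷ Γ)) p p' →
    Redex Γ (substP σ X) (left C') (substP σ (plug C' p'))
  internal-step C' p p' refl st =
    Redex-cast (sym (substP-plug σ C' p)) (left-substCtx sh C') (sym (substP-plug σ C' p'))
      (internal (substCtx σ C') (substP τ p) (substP τ p') refl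
        (subst (λ G → ProcStep G (substP τ p) (substP τ p')) (sym (holeCtx-substCtx σ C' Γ)) (ProcStep-substP (TypedSub-holeCtx sb C') st)))
    where τ = liftPN (depth C') σ

  crossL-step : ∀ C' A' B' u v D s ρ → X ≡ plug C' (par A' B' u v) → Leftmost u D s ρ →
    Redex Γ (substP σ X) (left C' + left D) (substP σ (plug C' (par A' B' (plug D (crossSub B' v s (depth D))) v)))
  crossL-step C' A' B' u v D s ρ refl lm =
    Redex-cast refl (cong₂ _+_ (left-substCtx sh C') (left-substCtx (VarsButλ-liftP shτ) D)) result≡
      (crossL (substCtx σ C') A' B' (substP (liftP τ) u) (substP (liftP τ) v) (substCtx (liftP τ) D)
          (substP (liftPN (depth D) (liftP τ)) s) (map (substE (liftPN (depth D) (liftP τ))) ρ)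
        (substP-plug σ C' _) (Leftmost-substP shτ u D s ρ lm))
    where
    τ = liftPN (depth C') σ
    shτ = VarsButλ-liftPN (depth C') sh
    result≡ = sym (trans (substP-plug σ C' _)
      (cong (λ z → plug (substCtx σ C') (par A' B' z (substP (liftP τ) v))) (substP-plug-crossSub τ D B' v s)))

  crossR-step : ∀ C' A' B' u v D s ρ → X ≡ plug C' (par A' B' u v) → NotAHeaded u → Leftmost v D s ρ →
    Redex Γ (substP σ X) (left C' + nproc u + left D) (substP σ (plug C' (par A' B' u (plug D (crossSub A' u s (depth D))))))
  crossR-step C' A' B' u v D s ρ refl nh lm =
    Redex-cast refl (cong₂ _+_ (cong₂ _+_ (left-substCtx sh C') (nproc-substP (VarsButλ-liftP shτ) u)) (left-substCtx (VarsButλ-liftP shτ) D))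
      result≡
      (crossR (substCtx σ C') A' B' (substP (liftP τ) u) (substP (liftP τ) v) (substCtx (liftP τ) D)
          (substP (liftPN (depth D) (liftP τ)) s) (map (substE (liftPN (depth D) (liftP τ))) ρ)
        (substP-plug σ C' _) (NotAHeaded-substP shτ u nh) (Leftmost-substP shτ v D s ρ lm))
    where
    τ = liftPN (depth C') σ
    shτ = VarsButλ-liftPN (depth C') sh
    result≡ = sym (trans (substP-plug σ C' _)
      (cong (λ z → plug (substCtx σ C') (par A' B' (substP (liftP τ) u) z)) (substP-plug-crossSub τ D A' u s)))

  -- X[𝒜/a] has the process (λx. 𝒜 (Y[λy.x/a])) s ρ where X has a s ρ: a β-step and an
  -- abort step turn it into Y[λy.s/a], the contractum of the outer cross reduction.
  a-step : ∀ D s ρ → Leftmost X D s ρ → NoRedexBefore Γ (substP σ X) (left D) →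
    Γ ⊢ substP σ X ≻⁺ substP σ (plug D (crossSub Q Y s (depth D)))
  a-step D s ρ (ah , _) H = ≻-intro r₁ H₁ ∷ [ ≻-intro r₂ H₂ ]
    where
    d = depth D
    τ = liftPN d σ
    D* = substCtx σ D
    s* = substP τ s
    ρ* = map (substE τ) ρ
    W = renP (liftR (d +_)) (substP (scrσ Q) Y)
    q₀ = (lam P (abort C Q · argP W) · argP s*) ◂ ρ*
    q₁ = (abort C Q · argP (sub1 s* W)) ◂ ρ*
    X≡ : substP σ X ≡ plug D* q₀
    X≡ = trans (cong (substP σ) ah) (trans (substP-plug σ D (varApp d s ρ)) (cong (plug D*) (substP-Scr-varApp P Q C Y d s ρ)))
    dq₀ : holeCtx D Γ ⊢ q₀ ∶ C
    dq₀ = subst (λ T → holeCtx D Γ ⊢ T ∶ C) (substP-Scr-varApp P Q C Y d s ρ)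
            (⊢-substP (TypedSub-holeCtx sb D) (⊢-plug {C = D} (subst (λ T → _ ⊢ T ∶ C) ah dX)))
    unfolded = ⊢-unfold-abort {P = P} {Q} {C} {W} {s*} {ρ*} dq₀
    inHole : ∀ {p p'} → ProcStep (holeCtx D Γ) p p' → ProcStep (holeCtx D* Γ) p p'
    inHole = subst (λ G → ProcStep G _ _) (sym (holeCtx-substCtx σ D Γ))
    result≡ : plug D* (sub1 s* W) ≡ substP σ (plug D (crossSub Q Y s d))
    result≡ = trans (cong (plug D*) (sub1-scrσ (Scr P Q C Y) Q Y d s)) (sym (substP-plug σ D _))
    r₁ : Redex Γ (substP σ X) (left D) (plug D* q₁)
    r₁ = Redex-cast (sym X≡) (left-substCtx sh D) refl (internal D* q₀ q₁ refl (inHole (basic {σ = ρ*} βλ)))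
    r₂ : Redex Γ (plug D* q₁) (left D) (substP σ (plug D (crossSub Q Y s d)))
    r₂ = Redex-cast refl (left-substCtx sh D) result≡
           (internal D* q₁ _ refl (inHole (abortS {σ = ρ*} (proj₂ unfolded) (proj₁ unfolded))))
    H₁ : NoRedexBefore Γ (substP σ X) (left D)
    H₁ = H
    H₂ : NoRedexBefore Γ (plug D* q₁) (left D)
    H₂ = subst (NoRedexBefore Γ (plug D* q₁)) (left-substCtx sh D)
           (NoRedexBefore-refill D* (Elementary-◂ _ ρ* refl) (Elementary-◂ _ ρ* refl)
             (subst₂ (NoRedexBefore Γ) X≡ (sym (left-substCtx sh D)) H))

simulate-left : ∀ {Γ A B C u v u' n R} → ((A ⇒ B) ∷ Γ) ⊢ u ∶ C → ((B ⇒ A) ∷ Γ) ⊢ v ∶ C →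
  NoRedexBefore Γ (par A B u v) n → Redex Γ (par A B u v) n R → R ≡ par A B u' v →
  Γ ⊢ substP (consP (Scr A B C v)) u ≻⁺ substP (consP (Scr A B C v)) u'
simulate-left {A = A} {B} {u = u} {v} _ _ _ (internal hole p p' e st) _ =
  ⊥-elim (par-not-Elementary {A} {B} {u} {v} (subst Elementary (sym e) (ProcStep-Elementary st)))
simulate-left du dv H (internal (inL _ _ C' _) p p' refl st) refl =
  [ ≻-intro (internal-step C' p p' refl st) (NoRedexBefore-substP (QuietBefore-inL H)) ]
  where open Simulation du dv
simulate-left du dv H (internal (inR _ _ _ C') p p' refl st) eR =
  ⊥-elim (step-irreflexive (⊢-plug {C = C'} dv) st (plug-injective C' (proj₂ (proj₂ (proj₂ (par-injective eR))))))
simulate-left du dv H (crossL hole _ _ _ _ D s ρ refl lm) refl =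
  a-step D s ρ lm (NoRedexBefore-substP (QuietBefore-inL H))
  where open Simulation du dv
simulate-left du dv H (crossL (inL _ _ C' _) A' B' u₁ v₁ D s ρ refl lm) refl =
  [ ≻-intro (crossL-step C' A' B' u₁ v₁ D s ρ refl lm) (NoRedexBefore-substP (QuietBefore-inL H)) ]
  where open Simulation du dv
simulate-left du dv H (crossL (inR _ _ _ C') _ B' _ v₁ D s ρ refl lm) eR with par-injective eR
... | _ , _ , _ , ev = ⊥-elim (crossSub-changes D s ρ B' v₁ lm (proj₁ (proj₂ (proj₂ (par-injective (plug-injective C' ev))))))
simulate-left du dv H (crossR hole A₀ _ u₀ _ D s ρ refl _ lm) eR =
  ⊥-elim (crossSub-changes D s ρ A₀ u₀ lm (proj₂ (proj₂ (proj₂ (par-injective eR)))))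
simulate-left du dv H (crossR (inL _ _ C' _) A' B' u₁ v₁ D s ρ refl nh lm) refl =
  [ ≻-intro (crossR-step C' A' B' u₁ v₁ D s ρ refl nh lm) (NoRedexBefore-substP (QuietBefore-inL H)) ]
  where open Simulation du dv
simulate-left du dv H (crossR (inR _ _ _ C') A' _ u₁ _ D s ρ refl _ lm) eR with par-injective eR
... | _ , _ , _ , ev = ⊥-elim (crossSub-changes D s ρ A' u₁ lm (proj₂ (proj₂ (proj₂ (par-injective (plug-injective C' ev))))))

simulate-right : ∀ {Γ A B C u v v' n R} → ((A ⇒ B) ∷ Γ) ⊢ u ∶ C → ((B ⇒ A) ∷ Γ) ⊢ v ∶ C →
  NoRedexBefore Γ (par A B u v) n → Redex Γ (par A B u v) n R → R ≡ par A B u v' →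
  Γ ⊢ substP (consP (Scr B A C u)) v ≻⁺ substP (consP (Scr B A C u)) v'
simulate-right {A = A} {B} {u = u} {v} _ _ _ (internal hole p p' e st) _ =
  ⊥-elim (par-not-Elementary {A} {B} {u} {v} (subst Elementary (sym e) (ProcStep-Elementary st)))
simulate-right du dv H (internal (inL _ _ C' _) p p' refl st) eR =
  ⊥-elim (step-irreflexive (⊢-plug {C = C'} du) st (plug-injective C' (proj₁ (proj₂ (proj₂ (par-injective eR))))))
simulate-right du dv H (internal (inR _ _ _ C') p p' refl st) refl =
  [ ≻-intro (internal-step C' p p' refl st) (NoRedexBefore-substP (QuietBefore-inR H refl)) ]
  where open Simulation dv du
simulate-right du dv H (crossL hole _ B₀ _ v₀ D s ρ refl lm) eR =
  ⊥-elim (crossSub-changes D s ρ B₀ v₀ lm (proj₁ (proj₂ (proj₂ (par-injective eR)))))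
simulate-right du dv H (crossL (inL _ _ C' _) _ B' _ v₁ D s ρ refl lm) eR with par-injective eR
... | _ , _ , eu , _ = ⊥-elim (crossSub-changes D s ρ B' v₁ lm (proj₁ (proj₂ (proj₂ (par-injective (plug-injective C' eu))))))
simulate-right {u = u} du dv H (crossL (inR _ _ _ C') A' B' u₁ v₁ D s ρ refl lm) refl =
  [ ≻-intro (crossL-step C' A' B' u₁ v₁ D s ρ refl lm)
            (NoRedexBefore-substP (QuietBefore-inR H (+-assoc (nproc u) (left C') (left D)))) ]
  where open Simulation dv du
simulate-right du dv H (crossR hole _ _ _ _ D s ρ refl _ lm) refl =
  a-step D s ρ lm (NoRedexBefore-substP (QuietBefore-inR H refl))
  where open Simulation dv du
simulate-right du dv H (crossR (inL _ _ C' _) A' _ u₁ _ D s ρ refl _ lm) eR with par-injective eR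
... | _ , _ , eu , _ = ⊥-elim (crossSub-changes D s ρ A' u₁ lm (proj₂ (proj₂ (proj₂ (par-injective (plug-injective C' eu))))))
simulate-right {u = u} du dv H (crossR (inR _ _ _ C') A' B' u₁ v₁ D s ρ refl nh lm) refl =
  [ ≻-intro (crossR-step C' A' B' u₁ v₁ D s ρ refl nh lm)
            (NoRedexBefore-substP (QuietBefore-inR H (+-assoc₄ (nproc u) (left C') (nproc u₁) (left D)))) ]
  where open Simulation dv du

proposition3p6 : (Γ : List Fm) (A B C : Fm) (u v : PT) →
    Γ ⊢ par A B u v ∶ C →
    ((u' : PT) → Γ ⊢ par A B u v ≻ par A B u' v →
      Γ ⊢ sub1 (scrA A B C v) u ≻⁺ sub1 (scrA A B C v) u')
    × ((v' : PT) → Γ ⊢ par A B u v ≻ par A B u v' →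
      Γ ⊢ sub1 (scrB A B C u) v ≻⁺ sub1 (scrB A B C u) v')
proposition3p6 Γ A B C u v (⊢par du dv) = left-case , right-case
  where
  left-case : (u' : PT) → Γ ⊢ par A B u v ≻ par A B u' v → Γ ⊢ sub1 (scrA A B C v) u ≻⁺ sub1 (scrA A B C v) u'
  left-case u' (_ , r , minimal) rewrite scrA≡Scr A B C v =
    simulate-left du dv (λ m (t , r') → minimal m t r') r refl
  right-case : (v' : PT) → Γ ⊢ par A B u v ≻ par A B u v' → Γ ⊢ sub1 (scrB A B C u) v ≻⁺ sub1 (scrB A B C u) v'
  right-case v' (_ , r , minimal) rewrite scrB≡Scr A B C u =
    simulate-right du dv (λ m (t , r') → minimal m t r') r refl
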